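{- Let $\Gamma$ be a finite program (rules may contain aggregate expressions in their bodies). Then every stable model of $\Gamma$ satisfies the completion of $\Gamma$.
   Context: Syntax. Fix pairwise disjoint sets of numerals, symbolic constants, variables, operation names (each with an arity) and aggregate names, not containing the special symbols $\mathit{inf}$, $\mathit{sup}$, $\mathit{not}$, $..$, the relation symbols $=,\neq,<,>,\le,\ge$, or logical symbols. There is a fixed bijection $n\mapsto\overline n$ from $\mathbb Z$ onto the numerals. Each $n$-ary operation name $\mathit{op}$ has a function $\widehat{\mathit{op}}$ from a subset of $\mathbb Z^n$ to $\mathbb Z$; each aggregate name $\alpha$ has a function $\widehat\alpha$ mapping every set of non-empty tuples of precomputed terms to a precomputed term. Terms: numerals, symbolic constants, variables, $\mathit{inf}$, $\mathit{sup}$; $f(\mathbf t)$ for a symbolic constant $f$ and a non-empty tuple of terms $\mathbf t$; $\mathit{op}(\mathbf t)$ for an $n$-ary operation name and an $n$-tuple of terms; $(t_1..t_2)$ for terms $t_1,t_2$. A term is ground if it has no variables, precomputed if it is ground and contains neither operation names nor $..$. A fixed total order on precomputed terms has $\mathit{inf}$ least, $\mathit{sup}$ greatest, and $\overline m\le\overline n$ iff $m\le n$; relation symbols are interpreted on precomputed terms via this order ($=$ is identity). The set $[t]$ of values of a ground term: $[t]=\{t\}$ for a numeral, symbolic constant, $\mathit{inf}$, $\mathit{sup}$; $[f(t_1,\dots,t_n)]=\{f(r_1,\dots,r_n): r_i\in[t_i]\}$; $[\mathit{op}(t_1,\dots,t_n)]$ is the set of numerals $\overline{\widehat{\mathit{op}}(k_1,\dots,k_n)}$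 for $(k_1,\dots,k_n)$ in the domain of $\widehat{\mathit{op}}$ with $\overline{k_i}\in[t_i]$; $[(t_1..t_2)]$ is the set of numerals $\overline m$ such that $k_1\le m\le k_2$ for some $\overline{k_1}\in[t_1],\overline{k_2}\in[t_2]$. For tuples, $[t_1,\dots,t_n]$ is the set of tuples $r_1,\dots,r_n$ with $r_i\in[t_i]$. An atom is $p(\mathbf t)$ with $p$ a symbolic constant and $\mathbf t$ a possibly empty tuple of terms; a literal is an atom or $\mathit{not}\ A$ for an atom $A$; a comparison is $(t_1\prec t_2)$ with $\prec$ a relation symbol; an aggregate expression is $\alpha\{\mathbf t:\mathbf C\}\prec s$ with $\mathbf t$ a non-empty tuple of terms, $\mathbf C$ a conjunction of literals and comparisons, and $s$ a variable or precomputed term. A rule is $\mathit{Head}\leftarrow\mathit{Body}$ where $\mathit{Body}$ is a (possibly empty) conjunction of literals, comparisons and aggregate expressions, and $\mathit{Head}$ is an atom (basic rule), an expression $\{A\}$ with $A$ an atom (choice rule), or empty (constraint). A program is a set of rules. A variable of a rule is local if every occurrence of it lies in the left-hand part $\alpha\{\mathbf t:\mathbf C\}$ of an aggregate expression in the body, and global otherwise. A predicate symbol is a pair $p/n$; it occurs in an expression if the expression contains an atom $p(t_1,\dots,t_n)$. The vocabulary of a program is the set of atoms $p(\mathbf r)$ with $\mathbf r$ an $n$-tuple of precomputed terms and $p/n$ occurring in it. An interpretation is a set of atoms $p(\mathbf r)$ with $\mathbf r$ a tuple of precomputed terms. Formulas and arguments (mutually recursive): (a) $p(\mathbf{arg})$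 for a symbolic constant $p$ and tuple of arguments; (b) $(\mathit{arg}_1\prec\mathit{arg}_2)$; (c) $\mathit{arg}\in t$ for an argument and a term $t$; (d) $\bot$; (e) $F\to G$; (f) $\forall X F$ are formulas; (g) numerals, symbolic constants, variables, $\mathit{inf}$, $\mathit{sup}$; (h) $f(\mathbf{arg})$ for a symbolic constant $f$ and non-empty tuple of arguments; (i) $\alpha\{\mathbf X\mid F\}$ for an aggregate name, non-empty tuple $\mathbf X$ of distinct variables, and formula $F$, are arguments. Other connectives and $\exists$ are the usual abbreviations. Occurrences of $X$ are bound if inside $\forall XF$ or inside $\alpha\{\mathbf X\mid F\}$ with $X$ in $\mathbf X$. For an interpretation $\mathcal I$, closed formulas get truth values and closed arguments get precomputed terms: $p(\mathit{arg}_1,..,\mathit{arg}_k)$ is true iff $p(\mathit{arg}_1^{\mathcal I},\dots,\mathit{arg}_k^{\mathcal I})\in\mathcal I$; $\mathit{arg}_1\prec\mathit{arg}_2$ is true iff $\mathit{arg}_1^{\mathcal I}\prec\mathit{arg}_2^{\mathcal I}$; $\mathit{arg}\in t$ is true iff $\mathit{arg}^{\mathcal I}\in[t]$; $\bot$ false; $\to$ classical; $\forall XF$ true iff $F^X_r$ is true for every precomputed term $r$; numerals, symbolic constants, $\mathit{inf},\mathit{sup}$ denote themselves; $f(\dots)^{\mathcal I}=f(\mathit{arg}_1^{\mathcal I},\dots)$; $\alpha\{X_1,\dots,X_k\mid F\}^{\mathcal I}=\widehat\alpha(T)$ where $T$ is the set of tuples $r_1,\dots,r_k$ of precomputed terms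 with $F^{X_1\dots X_k}_{r_1\dots r_k}$ true. Formula representation. $\phi\,p(\mathbf t)=\exists\mathbf X(\mathbf X\in\mathbf t\wedge p(\mathbf X))$; $\phi(\mathit{not}\ p(\mathbf t))=\exists\mathbf X(\mathbf X\in\mathbf t\wedge\neg p(\mathbf X))$; $\phi(t_1\prec t_2)=\exists X_1X_2(X_1\in t_1\wedge X_2\in t_2\wedge X_1\prec X_2)$, with new variables ($\mathbf X\in\mathbf t$ is the conjunction of the componentwise memberships). For a list $\mathbf X$ of distinct variables, $\phi^{\mathbf X}$ equals $\phi$ on literals and comparisons, and maps the aggregate expression $\alpha\{\mathbf t:\mathbf C\}\prec s$ to $\exists Y(\alpha\{\mathbf Z\mid\exists\mathbf X(\mathbf Z\in\mathbf t\wedge\phi\mathbf C)\}\prec Y\wedge Y\in s)$ with new $\mathbf Z,Y$; on conjunctions it acts conjunct-wise. With $\mathbf X$ the local variables of the rule and $\mathbf V$ new variables: a basic rule $p(\mathbf t)\leftarrow\mathit{Body}$ is represented by $\mathbf V\in\mathbf t\wedge\phi^{\mathbf X}(\mathit{Body})\to p(\mathbf V)$; a choice rule $\{p(\mathbf t)\}\leftarrow\mathit{Body}$ by $\mathbf V\in\mathbf t\wedge\phi^{\mathbf X}(\mathit{Body})\wedge p(\mathbf V)\to p(\mathbf V)$; a constraint $\leftarrow\mathit{Body}$ by $\neg\phi^{\mathbf X}(\mathit{Body})$. Completion. The definition of $p/n$ in $\Gamma$ consists of the basic rules of $\Gamma$ with head $p(t_1,\dots,t_n)$ and the choice rules with head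 $\{p(t_1,\dots,t_n)\}$. If it is $\{R_1,\dots,R_k\}$, write the representation of $R_i$ as $F_i\to p(\mathbf V)$ with the same tuple $\mathbf V$ of distinct variables for all $i$; the completed definition of $p/n$ is $\forall\mathbf V(p(\mathbf V)\leftrightarrow\bigvee_{i=1}^k\exists\mathbf U_iF_i)$, where $\mathbf U_i$ lists the free variables of $F_i$ not in $\mathbf V$. The completion of a finite program $\Gamma$ consists of the completed definitions of all predicate symbols occurring in $\Gamma$ and the universal closures of the formula representations of all constraints of $\Gamma$. Stable models. Infinitary formulas over a set of atoms: atoms, $\bot$, $\mathcal H^\wedge$ and $\mathcal H^\vee$ for any set $\mathcal H$ of infinitary formulas, and $G\to H$; $\neg F$ is $F\to\bot$, $\top$ is $\bot\to\bot$; satisfaction is classical. The reduct $F^{\mathcal I}$ is $\bot$ if $\mathcal I\not\models F$, and otherwise: $A$ for an atom $A$; $\{G^{\mathcal I}:G\in\mathcal H\}^\wedge$ resp. $^\vee$ for $\mathcal H^\wedge$, $\mathcal H^\vee$; $G^{\mathcal I}\to H^{\mathcal I}$ for $G\to H$. $\mathcal I$ is a stable model of $F$ if it is a minimal (w.r.t. inclusion) set of atoms satisfying $F^{\mathcal I}$. Translation $\tau$: for a ground atom, $\tau p(\mathbf t)=\bigvee_{\mathbf r\in[\mathbf t]}p(\mathbf r)$; $\tau(\mathit{not}\ p(\mathbf t))=\bigvee_{\mathbf r\in[\mathbf t]}\neg p(\mathbf r)$; for a ground comparison, $\tau(t_1\prec t_2)$ is $\top$ if $r_1\prec r_2$ for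 some $r_1\in[t_1],r_2\in[t_2]$, else $\bot$. An aggregate expression $E=\alpha\{\mathbf t:\mathbf C\}\prec s$ is closed if $s$ is ground; let $\mathbf X$ list its variables, $A$ the set of tuples of precomputed terms of length $|\mathbf X|$, and for $\Delta\subseteq A$ let $[\Delta]=\bigcup_{\mathbf r\in\Delta}[\mathbf t^{\mathbf X}_{\mathbf r}]$; $\Delta$ justifies $E$ if $\widehat\alpha([\Delta])\prec s$. Then $\tau E$ is the conjunction, over all $\Delta\subseteq A$ not justifying $E$, of $\bigwedge_{\mathbf r\in\Delta}\tau(\mathbf C^{\mathbf X}_{\mathbf r})\to\bigvee_{\mathbf r\in A\setminus\Delta}\tau(\mathbf C^{\mathbf X}_{\mathbf r})$. $\tau$ acts conjunct-wise on conjunctions. A rule is closed if all its variables are local; for closed rules: $\tau(p(\mathbf t)\leftarrow\mathit{Body})=\tau(\mathit{Body})\to\bigwedge_{\mathbf r\in[\mathbf t]}p(\mathbf r)$; $\tau(\{p(\mathbf t)\}\leftarrow\mathit{Body})=\tau(\mathit{Body})\to\bigwedge_{\mathbf r\in[\mathbf t]}(p(\mathbf r)\vee\neg p(\mathbf r))$; $\tau(\leftarrow\mathit{Body})=\neg\tau(\mathit{Body})$. An instance of a rule is the closed rule obtained by substituting precomputed terms for its global variables. $\tau\Gamma$ is the conjunction of $\tau R$ over all instances $R$ of rules of $\Gamma$, and the stable models of $\Gamma$ are the stable models of $\tau\Gamma$ (as sets of atoms from the vocabulary of $\Gamma$). -}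

module Defs where

open import Level using (Level; Lift; lift; lower) renaming (zero to lzero; suc to lsuc)
open import Data.Nat as ℕ using (ℕ; zero; suc)
open import Data.Integer as ℤ using (ℤ)
open import Data.Bool using (Bool; true; false; if_then_else_; not)
open import Data.Maybe using (Maybe; just; nothing; maybe)
open import Data.Fin using (Fin)
open import Data.Product using (Σ; _×_; _,_; proj₁; proj₂)
open import Data.Sum using (_⊎_; inj₁; inj₂)
open import Data.Unit using (⊤; tt)
open import Data.Empty using (⊥)
open import Data.List as List using (List; []; _∷_; _++_; concatMap; upTo; filter; length; lookup)
open import Data.List.NonEmpty as List⁺ using (List⁺; _∷_; toList)
open import Data.Vec as Vec using (Vec; []; _∷_)
open import Data.List.Membership.Propositional using (_∈_)
import Data.List.Membership.DecPropositional as DecMem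
open import Data.List.Relation.Unary.All using (All)
open import Relation.Nullary using (¬_; Dec; yes; no; does)
open import Relation.Nullary.Decidable using (⌊_⌋)
open import Relation.Binary using (IsTotalOrder; DecidableEquality)
open import Relation.Binary.PropositionalEquality using (_≡_; _≢_; refl; cong)
open import Function.Bundles using (_⇔_)

record Sig : Set₁ where
  field
    Sym     : Set
    _≟S_    : DecidableEquality Sym
    PV      : Set
    _≟V_    : DecidableEquality PV
    OpName  : Set
    arity   : OpName → ℕ
    opDom   : (o : OpName) → Vec ℤ (arity o) → Set
    opFun   : (o : OpName) (ks : Vec ℤ (arity o)) → opDom o ks → ℤ
    AggName : Set

module Syntax (S : Sig) where
  open Sig S

  data PTerm : Set where
    num : ℤ → PTerm
    con : Sym → PTerm
    inf sup : PTerm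
    fn  : Sym → List⁺ PTerm → PTerm

  data Term : Set where
    num : ℤ → Term
    con : Sym → Term
    var : PV → Term
    inf sup : Term
    fn  : Sym → List⁺ Term → Term
    op  : (o : OpName) → Vec Term (arity o) → Term
    rng : Term → Term → Term

  data Rel : Set where
    eq ne lt gt le ge : Rel

  data Lit : Set where
    pos neg : Sym → List Term → Lit

  -- elements of the conjunction C inside an aggregate
  data CElem : Set where
    clit : Lit → CElem
    ccmp : Rel → Term → Term → CElem

  -- body elements; in an aggregate expression  α{t : C} ≺ s,
  -- s is a variable (inj₁) or a precomputed term (inj₂)
  data BElem : Set where
    blit : Lit → BElem
    bcmp : Rel → Term → Term → BElem
    bagg : AggName → List⁺ Term → List CElem → Rel → PV ⊎ PTerm → BElem

  data Rule : Set where
    basic      : Sym → List Term → List BElem → Rule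
    choice     : Sym → List Term → List BElem → Rule
    constraint : List BElem → Rule

  Program : Set
  Program = List Rule

record Structure (S : Sig) : Set₁ where
  open Sig S
  open Syntax S
  field
    _≤ₚ_        : PTerm → PTerm → Set
    isTotalOrder : IsTotalOrder _≡_ _≤ₚ_
    inf-least    : ∀ r → inf ≤ₚ r
    sup-greatest : ∀ r → r ≤ₚ sup
    num-order    : ∀ m n → (num m ≤ₚ num n) ⇔ (m ℤ.≤ n)
    aggFun       : AggName → (List⁺ PTerm → Set) → PTerm
    -- α^ is a function of the *set*, i.e. respects extensional equality
    aggFun-ext   : ∀ α (P Q : List⁺ PTerm → Set) →
                   (∀ u → P u ⇔ Q u) → aggFun α P ≡ aggFun α Q

module Semantics (S : Sig) (O : Structure S) where
  open Sig S
  open Syntax S public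
  open Structure O

  ⟦_⟧ʳ : Rel → PTerm → PTerm → Set
  ⟦ eq ⟧ʳ a b = a ≡ b
  ⟦ ne ⟧ʳ a b = a ≢ b
  ⟦ lt ⟧ʳ a b = (a ≤ₚ b) × (a ≢ b)
  ⟦ gt ⟧ʳ a b = (b ≤ₚ a) × (a ≢ b)
  ⟦ le ⟧ʳ a b = a ≤ₚ b
  ⟦ ge ⟧ʳ a b = b ≤ₚ a

  -- the set [t] of values of a (ground) term, as a predicate.
  -- Variables have no values (they never occur: [_] is used on ground terms).
  mutual
    vals : Term → PTerm → Set
    vals (num n) r = r ≡ num n
    vals (con c) r = r ≡ con c
    vals (var x) r = ⊥
    vals inf r = r ≡ inf
    vals sup r = r ≡ sup
    vals (fn f (t ∷ ts)) r =
      Σ PTerm λ r₀ → Σ (List PTerm) λ rs →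
        (r ≡ fn f (r₀ ∷ rs)) × vals t r₀ × valsL ts rs
    vals (op o ts) r =
      Σ (Vec ℤ (arity o)) λ ks → Σ (opDom o ks) λ d →
        (r ≡ num (opFun o ks d)) × valsVec ts ks
    vals (rng t₁ t₂) r =
      Σ ℤ λ m → Σ ℤ λ k₁ → Σ ℤ λ k₂ →
        (r ≡ num m) × vals t₁ (num k₁) × vals t₂ (num k₂) × (k₁ ℤ.≤ m) × (m ℤ.≤ k₂)

    valsL : List Term → List PTerm → Set
    valsL [] [] = ⊤
    valsL [] (_ ∷ _) = ⊥
    valsL (_ ∷ _) [] = ⊥
    valsL (t ∷ ts) (r ∷ rs) = vals t r × valsL ts rs

    valsVec : ∀ {n} → Vec Term n → Vec ℤ n → Set
    valsVec [] [] = ⊤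
    valsVec (t ∷ ts) (k ∷ ks) = vals t (num k) × valsVec ts ks

  valsTuple : List⁺ Term → List⁺ PTerm → Set
  valsTuple (t ∷ ts) (r ∷ rs) = vals t r × valsL ts rs

  mutual
    ⌜_⌝ : PTerm → Term
    ⌜ num n ⌝ = num n
    ⌜ con c ⌝ = con c
    ⌜ inf ⌝ = inf
    ⌜ sup ⌝ = sup
    ⌜ fn f (r ∷ rs) ⌝ = fn f (⌜ r ⌝ ∷ ⌜ rs ⌝L)

    ⌜_⌝L : List PTerm → List Term
    ⌜ [] ⌝L = []
    ⌜ r ∷ rs ⌝L = ⌜ r ⌝ ∷ ⌜ rs ⌝L

  Sub : Set
  Sub = PV → Maybe PTerm

  mutual
    substT : Sub → Term → Term
    substT σ (num n) = num n
    substT σ (con c) = con c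
    substT σ (var x) = maybe ⌜_⌝ (var x) (σ x)
    substT σ inf = inf
    substT σ sup = sup
    substT σ (fn f (t ∷ ts)) = fn f (substT σ t ∷ substL σ ts)
    substT σ (op o ts) = op o (substV σ ts)
    substT σ (rng t₁ t₂) = rng (substT σ t₁) (substT σ t₂)

    substL : Sub → List Term → List Term
    substL σ [] = []
    substL σ (t ∷ ts) = substT σ t ∷ substL σ ts

    substV : ∀ {n} → Sub → Vec Term n → Vec Term n
    substV σ [] = []
    substV σ (t ∷ ts) = substT σ t ∷ substV σ ts

  substT⁺ : Sub → List⁺ Term → List⁺ Term
  substT⁺ σ (t ∷ ts) = substT σ t ∷ substL σ ts

  substLit : Sub → Lit → Lit
  substLit σ (pos p ts) = pos p (substL σ ts)
  substLit σ (neg p ts) = neg p (substL σ ts)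

  substC : Sub → CElem → CElem
  substC σ (clit l) = clit (substLit σ l)
  substC σ (ccmp ≺ t₁ t₂) = ccmp ≺ (substT σ t₁) (substT σ t₂)

  substCs : Sub → List CElem → List CElem
  substCs σ = List.map (substC σ)

  substS : Sub → PV ⊎ PTerm → PV ⊎ PTerm
  substS σ (inj₁ x) = maybe inj₂ (inj₁ x) (σ x)
  substS σ (inj₂ r) = inj₂ r

  substB : Sub → BElem → BElem
  substB σ (blit l) = blit (substLit σ l)
  substB σ (bcmp ≺ t₁ t₂) = bcmp ≺ (substT σ t₁) (substT σ t₂)
  substB σ (bagg α ts cs ≺ s) = bagg α (substT⁺ σ ts) (substCs σ cs) ≺ (substS σ s)

  substR : Sub → Rule → Rule
  substR σ (basic p ts bs) = basic p (substL σ ts) (List.map (substB σ) bs)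
  substR σ (choice p ts bs) = choice p (substL σ ts) (List.map (substB σ) bs)
  substR σ (constraint bs) = constraint (List.map (substB σ) bs)

  open DecMem _≟V_ using () renaming (_∈?_ to _∈V?_)

  dedupV : List PV → List PV
  dedupV = List.deduplicate _≟V_

  mutual
    varsT : Term → List PV
    varsT (num _) = []
    varsT (con _) = []
    varsT (var x) = x ∷ []
    varsT inf = []
    varsT sup = []
    varsT (fn f (t ∷ ts)) = varsT t ++ varsL ts
    varsT (op o ts) = varsV ts
    varsT (rng t₁ t₂) = varsT t₁ ++ varsT t₂

    varsL : List Term → List PV
    varsL [] = []
    varsL (t ∷ ts) = varsT t ++ varsL ts

    varsV : ∀ {n} → Vec Term n → List PV
    varsV [] = []
    varsV (t ∷ ts) = varsT t ++ varsV ts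

  varsT⁺ : List⁺ Term → List PV
  varsT⁺ (t ∷ ts) = varsT t ++ varsL ts

  varsLit : Lit → List PV
  varsLit (pos _ ts) = varsL ts
  varsLit (neg _ ts) = varsL ts

  varsC : CElem → List PV
  varsC (clit l) = varsLit l
  varsC (ccmp _ t₁ t₂) = varsT t₁ ++ varsT t₂

  varsS : PV ⊎ PTerm → List PV
  varsS (inj₁ x) = x ∷ []
  varsS (inj₂ _) = []

  varsAggLeft : List⁺ Term → List CElem → List PV
  varsAggLeft ts cs = varsT⁺ ts ++ concatMap varsC cs

  globalsB : BElem → List PV
  globalsB (blit l) = varsLit l
  globalsB (bcmp _ t₁ t₂) = varsT t₁ ++ varsT t₂
  globalsB (bagg _ _ _ _ s) = varsS s

  aggVarsB : BElem → List PV
  aggVarsB (bagg _ ts cs _ _) = varsAggLeft ts cs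
  aggVarsB _ = []

  body : Rule → List BElem
  body (basic _ _ bs) = bs
  body (choice _ _ bs) = bs
  body (constraint bs) = bs

  headVars : Rule → List PV
  headVars (basic _ ts _) = varsL ts
  headVars (choice _ _ _) = []
  headVars (constraint _) = []

  headVars′ : Rule → List PV
  headVars′ (basic _ ts _) = varsL ts
  headVars′ (choice _ ts _) = varsL ts
  headVars′ (constraint _) = []

  globals : Rule → List PV
  globals R = dedupV (headVars′ R ++ concatMap globalsB (body R))

  locals : Rule → List PV
  locals R = dedupV (filter (λ x → Relation.Nullary.¬? (x ∈V? globals R))
                            (concatMap aggVarsB (body R)))

  PredSym : Set
  PredSym = Sym × ℕ

  predsLit : Lit → List PredSym
  predsLit (pos p ts) = (p , length ts) ∷ []
  predsLit (neg p ts) = (p , length ts) ∷ []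

  predsC : CElem → List PredSym
  predsC (clit l) = predsLit l
  predsC (ccmp _ _ _) = []

  predsB : BElem → List PredSym
  predsB (blit l) = predsLit l
  predsB (bcmp _ _ _) = []
  predsB (bagg _ _ cs _ _) = concatMap predsC cs

  predsR : Rule → List PredSym
  predsR (basic p ts bs) = (p , length ts) ∷ concatMap predsB bs
  predsR (choice p ts bs) = (p , length ts) ∷ concatMap predsB bs
  predsR (constraint bs) = concatMap predsB bs

  preds : Program → List PredSym
  preds = concatMap predsR

  Atom : Set
  Atom = Sym × List PTerm

  Interp : Set₁
  Interp = Atom → Set

  _⊆_ : Interp → Interp → Set
  J ⊆ I = ∀ a → J a → I a

  vocabulary : Program → Interp
  vocabulary Γ (p , rs) = (p , length rs) ∈ preds Γ

  -- infinitary formulas over the atoms; conjunctions / disjunctions of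
  -- arbitrary sets of formulas are given as families indexed by a type
  data IF : Set₂ where
    atomI : Atom → IF
    botI  : IF
    conjI : (Ix : Set₁) → (Ix → IF) → IF
    disjI : (Ix : Set₁) → (Ix → IF) → IF
    implI : IF → IF → IF

  ⋀ₛ : {Ix : Set} → (Ix → IF) → IF
  ⋀ₛ {Ix} f = conjI (Lift _ Ix) (λ i → f (lower i))

  ⋁ₛ : {Ix : Set} → (Ix → IF) → IF
  ⋁ₛ {Ix} f = disjI (Lift _ Ix) (λ i → f (lower i))

  ¬I : IF → IF
  ¬I F = implI F botI

  ⊤I : IF
  ⊤I = implI botI botI

  _∨I_ : IF → IF → IF
  F ∨I G = ⋁ₛ {Bool} (λ b → if b then F else G)

  _⊨_ : Interp → IF → Set₁
  I ⊨ atomI a = Lift _ (I a)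
  I ⊨ botI = Lift _ ⊥
  I ⊨ conjI Ix f = ∀ i → I ⊨ f i
  I ⊨ disjI Ix f = Σ Ix λ i → I ⊨ f i
  I ⊨ implI F G = I ⊨ F → I ⊨ G

  -- J ⊨ F^I  (the reduct F^I is ⊥ if I ⊭ F, and otherwise is
  -- obtained by reducing the immediate subformulas)
  mutual
    _⊨red[_]_ : Interp → Interp → IF → Set₁
    J ⊨red[ I ] F = (I ⊨ F) × redBody J I F

    redBody : Interp → Interp → IF → Set₁
    redBody J I (atomI a) = Lift _ (J a)
    redBody J I botI = Lift _ ⊥
    redBody J I (conjI Ix f) = ∀ i → J ⊨red[ I ] f i
    redBody J I (disjI Ix f) = Σ Ix λ i → J ⊨red[ I ] f i
    redBody J I (implI F G) = J ⊨red[ I ] F → J ⊨red[ I ] G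

  IsStableModel : IF → Interp → Set₁
  IsStableModel F I =
    (I ⊨red[ I ] F) × (∀ (J : Interp) → J ⊆ I → J ⊨red[ I ] F → I ⊆ J)

  τLit : Lit → IF
  τLit (pos p ts) = ⋁ₛ {Σ (List PTerm) (valsL ts)} (λ rs → atomI (p , proj₁ rs))
  τLit (neg p ts) = ⋁ₛ {Σ (List PTerm) (valsL ts)} (λ rs → ¬I (atomI (p , proj₁ rs)))

  -- ⊤ if r₁ ≺ r₂ for some r₁ ∈ [t₁], r₂ ∈ [t₂], else ⊥ (an empty disjunction)
  τCmp : Rel → Term → Term → IF
  τCmp ≺ t₁ t₂ =
    ⋁ₛ {Σ PTerm λ r₁ → Σ PTerm λ r₂ → vals t₁ r₁ × vals t₂ r₂ × ⟦ ≺ ⟧ʳ r₁ r₂}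
       (λ _ → ⊤I)

  τC : CElem → IF
  τC (clit l) = τLit l
  τC (ccmp ≺ t₁ t₂) = τCmp ≺ t₁ t₂

  τCs : List CElem → IF
  τCs cs = ⋀ₛ {Fin (length cs)} (λ i → τC (lookup cs i))

  assoc : List PV → List PTerm → Sub
  assoc [] _ x = nothing
  assoc (_ ∷ _) [] x = nothing
  assoc (y ∷ ys) (r ∷ rs) x = if ⌊ x ≟V y ⌋ then just r else assoc ys rs x

  module Agg (α : AggName) (ts : List⁺ Term) (cs : List CElem)
             (≺ : Rel) (s : PV ⊎ PTerm) where
    Xs : List PV
    Xs = dedupV (varsAggLeft ts cs)

    k : ℕ
    k = length Xs

    A : Set
    A = Vec PTerm k

    σ : A → Sub
    σ r = assoc Xs (Vec.toList r)

    valsΔ : (A → Set) → List⁺ PTerm → Set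
    valsΔ Δ u = Σ A λ r → Δ r × valsTuple (substT⁺ (σ r) ts) u

    justifiesWrt : PV ⊎ PTerm → (A → Set) → Set
    justifiesWrt (inj₂ r) Δ = ⟦ ≺ ⟧ʳ (aggFun α (valsΔ Δ)) r
    justifiesWrt (inj₁ _) Δ = ⊥          -- only closed expressions are translated

    justifies : (A → Set) → Set
    justifies = justifiesWrt s

    τAgg : IF
    τAgg = conjI (Σ (A → Set) λ Δ → ¬ justifies Δ) λ Δj →
      implI (⋀ₛ {Σ A (proj₁ Δj)} (λ r → τCs (substCs (σ (proj₁ r)) cs)))
            (⋁ₛ {Σ A (λ r → ¬ proj₁ Δj r)} (λ r → τCs (substCs (σ (proj₁ r)) cs)))

  τB : BElem → IF
  τB (blit l) = τLit l
  τB (bcmp ≺ t₁ t₂) = τCmp ≺ t₁ t₂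
  τB (bagg α ts cs ≺ s) = Agg.τAgg α ts cs ≺ s

  τBody : List BElem → IF
  τBody bs = ⋀ₛ {Fin (length bs)} (λ i → τB (lookup bs i))

  τRule : Rule → IF
  τRule (basic p ts bs) =
    implI (τBody bs) (⋀ₛ {Σ (List PTerm) (valsL ts)} (λ rs → atomI (p , proj₁ rs)))
  τRule (choice p ts bs) =
    implI (τBody bs) (⋀ₛ {Σ (List PTerm) (valsL ts)}
                        (λ rs → atomI (p , proj₁ rs) ∨I ¬I (atomI (p , proj₁ rs))))
  τRule (constraint bs) = ¬I (τBody bs)

  instanceOf : Rule → (PV → PTerm) → Rule
  instanceOf R ρ = substR (λ x → if does (x ∈V? globals R) then just (ρ x) else nothing) R

  τProgram : Program → IF
  τProgram Γ = ⋀ₛ {Fin (length Γ) × (PV → PTerm)}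
                  (λ iρ → τRule (instanceOf (lookup Γ (proj₁ iρ)) (proj₂ iρ)))

  StableModel : Program → Interp → Set₁
  StableModel Γ I = (I ⊆ vocabulary Γ) × IsStableModel (τProgram Γ) I

  -- variables of formulas: program variables, and new variables
  -- (the tuple V of the completion, the Z and Y of aggregate
  -- representations, and the X's of literal/comparison representations)
  data Var : Set where
    prog : PV → Var
    vV   : ℕ → Var
    vZ   : ℕ → Var
    vY   : Var
    vL   : ℕ → Var

  _≟Var_ : DecidableEquality Var
  prog x ≟Var prog y with x ≟V y
  ... | yes refl = yes refl
  ... | no x≢y = no λ { refl → x≢y refl }
  vV m ≟Var vV n with m ℕ.≟ n
  ... | yes refl = yes refl
  ... | no m≢n = no λ { refl → m≢n refl }
  vZ m ≟Var vZ n with m ℕ.≟ n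
  ... | yes refl = yes refl
  ... | no m≢n = no λ { refl → m≢n refl }
  vY ≟Var vY = yes refl
  vL m ≟Var vL n with m ℕ.≟ n
  ... | yes refl = yes refl
  ... | no m≢n = no λ { refl → m≢n refl }
  prog _ ≟Var vV _ = no λ ()
  prog _ ≟Var vZ _ = no λ ()
  prog _ ≟Var vY = no λ ()
  prog _ ≟Var vL _ = no λ ()
  vV _ ≟Var prog _ = no λ ()
  vV _ ≟Var vZ _ = no λ ()
  vV _ ≟Var vY = no λ ()
  vV _ ≟Var vL _ = no λ ()
  vZ _ ≟Var prog _ = no λ ()
  vZ _ ≟Var vV _ = no λ ()
  vZ _ ≟Var vY = no λ ()
  vZ _ ≟Var vL _ = no λ ()
  vY ≟Var prog _ = no λ ()
  vY ≟Var vV _ = no λ ()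
  vY ≟Var vZ _ = no λ ()
  vY ≟Var vL _ = no λ ()
  vL _ ≟Var prog _ = no λ ()
  vL _ ≟Var vV _ = no λ ()
  vL _ ≟Var vZ _ = no λ ()
  vL _ ≟Var vY = no λ ()

  open DecMem _≟Var_ using () renaming (_∈?_ to _∈Var?_)

  mutual
    data Formula : Set where
      atomF : Sym → List Arg → Formula
      cmpF  : Rel → Arg → Arg → Formula
      memF  : Arg → Term → Formula
      botF  : Formula
      impF  : Formula → Formula → Formula
      allF  : Var → Formula → Formula

    data Arg : Set where
      numA  : ℤ → Arg
      conA  : Sym → Arg
      varA  : Var → Arg
      infA supA : Arg
      fnA   : Sym → List⁺ Arg → Arg
      aggA  : AggName → List⁺ Var → Formula → Arg

  ¬F : Formula → Formula
  ¬F F = impF F botF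

  ⊤F : Formula
  ⊤F = ¬F botF

  _∧F_ : Formula → Formula → Formula
  F ∧F G = ¬F (impF F (¬F G))

  _∨F_ : Formula → Formula → Formula
  F ∨F G = impF (¬F F) G

  _↔F_ : Formula → Formula → Formula
  F ↔F G = impF F G ∧F impF G F

  exF : Var → Formula → Formula
  exF X F = ¬F (allF X (¬F F))

  ∀⃗ : List Var → Formula → Formula
  ∀⃗ Xs F = List.foldr allF F Xs

  ∃⃗ : List Var → Formula → Formula
  ∃⃗ Xs F = List.foldr exF F Xs

  ⋀F : List Formula → Formula
  ⋀F [] = ⊤F
  ⋀F (F ∷ []) = F
  ⋀F (F ∷ G ∷ Fs) = F ∧F ⋀F (G ∷ Fs)

  ⋁F : List Formula → Formula
  ⋁F [] = botF
  ⋁F (F ∷ []) = F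
  ⋁F (F ∷ G ∷ Fs) = F ∨F ⋁F (G ∷ Fs)

  -- truth of formulas / values of arguments, w.r.t. an assignment of
  -- precomputed terms to the free variables (F^X_r is F under ρ[X ↦ r])
  Env : Set
  Env = Var → PTerm

  _[_↦_] : Env → Var → PTerm → Env
  (ρ [ X ↦ r ]) Y = if ⌊ Y ≟Var X ⌋ then r else ρ Y

  updates : Env → List Var → List PTerm → Env
  updates ρ (X ∷ Xs) (r ∷ rs) = updates (ρ [ X ↦ r ]) Xs rs
  updates ρ _ _ = ρ

  progSub : Env → Sub
  progSub ρ x = just (ρ (prog x))

  module _ (I : Interp) where
    mutual
      truth : Formula → Env → Set
      truth (atomF p as) ρ = I (p , evalL as ρ)
      truth (cmpF ≺ a b) ρ = ⟦ ≺ ⟧ʳ (eval a ρ) (eval b ρ)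
      truth (memF a t) ρ = vals (substT (progSub ρ) t) (eval a ρ)
      truth botF ρ = ⊥
      truth (impF F G) ρ = truth F ρ → truth G ρ
      truth (allF X F) ρ = ∀ r → truth F (ρ [ X ↦ r ])

      eval : Arg → Env → PTerm
      eval (numA n) ρ = num n
      eval (conA c) ρ = con c
      eval (varA X) ρ = ρ X
      eval infA ρ = inf
      eval supA ρ = sup
      eval (fnA f (a ∷ as)) ρ = fn f (eval a ρ ∷ evalL as ρ)
      eval (aggA α Xs F) ρ =
        aggFun α (λ u → (List⁺.length u ≡ List⁺.length Xs)
                        × truth F (updates ρ (toList Xs) (toList u)))

      evalL : List Arg → Env → List PTerm
      evalL [] ρ = []
      evalL (a ∷ as) ρ = eval a ρ ∷ evalL as ρ

  -- closed formulas (the choice of the assignment is immaterial)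
  _⊨F_ : Interp → Formula → Set
  I ⊨F F = truth I F (λ _ → inf)

  mutual
    fvF : Formula → List Var
    fvF (atomF _ as) = fvL as
    fvF (cmpF _ a b) = fvA a ++ fvA b
    fvF (memF a t) = fvA a ++ List.map prog (varsT t)
    fvF botF = []
    fvF (impF F G) = fvF F ++ fvF G
    fvF (allF X F) = filter (λ Y → Relation.Nullary.¬? (Y ≟Var X)) (fvF F)

    fvA : Arg → List Var
    fvA (numA _) = []
    fvA (conA _) = []
    fvA (varA X) = X ∷ []
    fvA infA = []
    fvA supA = []
    fvA (fnA _ (a ∷ as)) = fvA a ++ fvL as
    fvA (aggA _ Xs F) = filter (λ Y → Relation.Nullary.¬? (Y ∈Var? toList Xs)) (fvF F)

    fvL : List Arg → List Var
    fvL [] = []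
    fvL (a ∷ as) = fvA a ++ fvL as

  dedupVar : List Var → List Var
  dedupVar = List.deduplicate _≟Var_

  fresh : (ℕ → Var) → ℕ → List Var
  fresh v n = List.map v (upTo n)

  memAll : List Var → List Term → Formula
  memAll Xs ts = ⋀F (List.zipWith (λ X t → memF (varA X) t) Xs ts)

  φLit : Lit → Formula
  φLit (pos p ts) = ∃⃗ Ls (memAll Ls ts ∧F atomF p (List.map varA Ls))
    where Ls = fresh vL (length ts)
  φLit (neg p ts) = ∃⃗ Ls (memAll Ls ts ∧F ¬F (atomF p (List.map varA Ls)))
    where Ls = fresh vL (length ts)

  φCmp : Rel → Term → Term → Formula
  φCmp ≺ t₁ t₂ = exF (vL 0) (exF (vL 1)
    (⋀F (memF (varA (vL 0)) t₁ ∷ memF (varA (vL 1)) t₂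
         ∷ cmpF ≺ (varA (vL 0)) (varA (vL 1)) ∷ [])))

  φC : CElem → Formula
  φC (clit l) = φLit l
  φC (ccmp ≺ t₁ t₂) = φCmp ≺ t₁ t₂

  φCs : List CElem → Formula
  φCs cs = ⋀F (List.map φC cs)

  sTerm : PV ⊎ PTerm → Term
  sTerm (inj₁ x) = var x
  sTerm (inj₂ r) = ⌜ r ⌝

  -- φ^X, X the local variables of the rule
  φB : List PV → BElem → Formula
  φB Xs (blit l) = φLit l
  φB Xs (bcmp ≺ t₁ t₂) = φCmp ≺ t₁ t₂
  φB Xs (bagg α (t ∷ ts) cs ≺ s) =
    exF vY (cmpF ≺ (aggA α Zs (∃⃗ (List.map prog Xs)
                                 (memAll (toList Zs) (t ∷ ts) ∧F φCs cs)))
                   (varA vY)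
            ∧F memF (varA vY) (sTerm s))
    where Zs = vZ 0 ∷ fresh (λ i → vZ (suc i)) (length ts)

  φBody : List PV → List BElem → Formula
  φBody Xs bs = ⋀F (List.map (φB Xs) bs)

  -- the antecedent F of the representation  F → p(V)  of a basic or
  -- choice rule, for the tuple of new variables Vs
  repAnte : List Var → Rule → Formula
  repAnte Vs R@(basic p ts bs) = memAll Vs ts ∧F φBody (locals R) bs
  repAnte Vs R@(choice p ts bs) =
    ⋀F (memAll Vs ts ∷ φBody (locals R) bs ∷ atomF p (List.map varA Vs) ∷ [])
  repAnte Vs (constraint bs) = botF      -- not used

  inDefinition : PredSym → Rule → Bool
  inDefinition (p , n) (basic q ts _) = ⌊ q ≟S p ⌋ Data.Bool.∧ ⌊ length ts ℕ.≟ n ⌋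
  inDefinition (p , n) (choice q ts _) = ⌊ q ≟S p ⌋ Data.Bool.∧ ⌊ length ts ℕ.≟ n ⌋
  inDefinition (p , n) (constraint _) = false

  definition : Program → PredSym → List Rule
  definition [] pn = []
  definition (R ∷ Γ) pn =
    if inDefinition pn R then R ∷ definition Γ pn else definition Γ pn

  completedDefinition : Program → PredSym → Formula
  completedDefinition Γ (p , n) =
    ∀⃗ Vs (atomF p (List.map varA Vs) ↔F
          ⋁F (List.map (λ R → ∃⃗ (U R) (repAnte Vs R)) (definition Γ (p , n))))
    where
      Vs = fresh vV n
      U : Rule → List Var
      U R = dedupVar (filter (λ Y → Relation.Nullary.¬? (Y ∈Var? Vs)) (fvF (repAnte Vs R)))

  universalClosure : Formula → Formula
  universalClosure F = ∀⃗ (dedupVar (fvF F)) F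

  constraintFormulas : Program → List Formula
  constraintFormulas [] = []
  constraintFormulas (R@(constraint bs) ∷ Γ) =
    universalClosure (¬F (φBody (locals R) bs)) ∷ constraintFormulas Γ
  constraintFormulas (_ ∷ Γ) = constraintFormulas Γ

  completion : Program → List Formula
  completion Γ = List.map (completedDefinition Γ) (preds Γ) ++ constraintFormulas Γ

  SatisfiesCompletion : Program → Interp → Set
  SatisfiesCompletion Γ I = All (I ⊨F_) (completion Γ)

module Submission where

-- The formula representation φ and the infinitary translation τ agree on every instance
-- of a rule body, under an assignment extending the instance's values of the global
-- variables: for literals and comparisons by unfolding, and for an aggregate expression
-- because its τ holds in I exactly when the set of tuples whose conditions hold in I
-- justifies it, which is the set the aggregate is applied to in φ. So every model of τΓ
-- satisfies the constraints of the completion and the "if" halves of the completed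
-- definitions. For the "only if" halves, every atom of a stable model I is supported by
-- a rule instance whose body holds in I: otherwise I without that atom would satisfy the
-- reduct of τΓ, contradicting minimality. Existential quantifiers of formulas are encoded
-- as ¬∀¬, so extracting their witnesses needs excluded middle.

open import Defs
open import Level using (Lift; lift; lower) renaming (zero to lzero; suc to lsuc)
open import Axiom.ExcludedMiddle using (ExcludedMiddle)
open import Data.Nat as ℕ using (ℕ; suc)
open import Data.Bool using (true; false; if_then_else_; _∧_)
open import Data.Maybe using (just; nothing; maybe; fromMaybe)
open import Data.Fin using () renaming (zero to fzero; suc to fsuc)
open import Data.Product as Product using (Σ; _×_; _,_; proj₁; proj₂; map₂)
open import Data.Sum as Sum using (_⊎_; inj₁; inj₂; [_,_]′)
open import Data.Unit using (tt)
open import Data.Empty using (⊥; ⊥-elim)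
open import Data.List as List using (List; []; _∷_; _++_; length)
open import Data.List.Properties using (length-map; length-upTo)
open import Data.List.NonEmpty as List⁺ using (List⁺; _∷_; toList)
open import Data.Vec as Vec using (Vec; []; _∷_)
open import Data.Vec.Properties using (toList-map; toList∘fromList; length-toList)
open import Data.List.Membership.Propositional using (_∈_; _∉_; find; lose)
open import Data.List.Membership.Propositional.Properties
open import Data.List.Relation.Unary.Any using (Any; here; there)
open import Data.List.Relation.Unary.Any.Properties using (map⁻)
open import Data.List.Relation.Unary.All as All using (All; []; _∷_)
open import Data.List.Relation.Unary.All.Properties
  using (++⁻ˡ; ++⁻ʳ; ++⁺; All¬⇒¬Any) renaming (map⁺ to All-map⁺)
open import Data.List.Relation.Unary.Unique.Propositional using (Unique)
import Data.List.Relation.Unary.Unique.Propositional.Properties as Unique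
import Data.List.Relation.Unary.Unique.DecPropositional.Properties as UniqueDec
open import Data.List.Relation.Unary.AllPairs using ([]; _∷_)
open import Data.List.Relation.Binary.Pointwise.Base using (Pointwise; []; _∷_)
import Data.List.Membership.DecPropositional as DecMembership
open import Relation.Nullary using (¬_; Dec; yes; no; does; ¬?)
open import Relation.Nullary.Decidable using (⌊_⌋; map′; decidable-stable; dec-true; toSum)
open import Relation.Binary.PropositionalEquality
  using (_≡_; _≢_; refl; sym; trans; cong; cong₂; subst; subst₂; module ≡-Reasoning)
open import Function using (_∘_)
open import Function.Bundles using (_⇔_; mk⇔)

module _ (S : Sig) (O : Structure S) where
  open Sig S
  open Structure O
  open Semantics S O

  _≗_on_ : Sub → Sub → List PV → Set
  σ ≗ σ′ on xs = All (λ x → σ x ≡ σ′ x) xs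

  mutual
    substT-cong : ∀ {σ σ′} t → σ ≗ σ′ on varsT t → substT σ t ≡ substT σ′ t
    substT-cong (num n) _ = refl
    substT-cong (con c) _ = refl
    substT-cong (var x) (e ∷ []) = cong (maybe ⌜_⌝ (var x)) e
    substT-cong inf _ = refl
    substT-cong sup _ = refl
    substT-cong (fn f (t ∷ ts)) h =
      cong₂ (λ a b → fn f (a ∷ b)) (substT-cong t (++⁻ˡ (varsT t) h)) (substL-cong ts (++⁻ʳ (varsT t) h))
    substT-cong (op o ts) h = cong (op o) (substV-cong ts h)
    substT-cong (rng t₁ t₂) h =
      cong₂ rng (substT-cong t₁ (++⁻ˡ (varsT t₁) h)) (substT-cong t₂ (++⁻ʳ (varsT t₁) h))

    substL-cong : ∀ {σ σ′} ts → σ ≗ σ′ on varsL ts → substL σ ts ≡ substL σ′ ts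
    substL-cong [] _ = refl
    substL-cong (t ∷ ts) h = cong₂ _∷_ (substT-cong t (++⁻ˡ (varsT t) h)) (substL-cong ts (++⁻ʳ (varsT t) h))

    substV-cong : ∀ {σ σ′ n} (ts : Vec Term n) → σ ≗ σ′ on varsV ts → substV σ ts ≡ substV σ′ ts
    substV-cong [] _ = refl
    substV-cong (t ∷ ts) h = cong₂ _∷_ (substT-cong t (++⁻ˡ (varsT t) h)) (substV-cong ts (++⁻ʳ (varsT t) h))

  substLit-cong : ∀ {σ σ′} l → σ ≗ σ′ on varsLit l → substLit σ l ≡ substLit σ′ l
  substLit-cong (pos p ts) h = cong (pos p) (substL-cong ts h)
  substLit-cong (neg p ts) h = cong (neg p) (substL-cong ts h)

  substC-cong : ∀ {σ σ′} c → σ ≗ σ′ on varsC c → substC σ c ≡ substC σ′ c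
  substC-cong (clit l) h = cong clit (substLit-cong l h)
  substC-cong (ccmp ≺ t₁ t₂) h =
    cong₂ (ccmp ≺) (substT-cong t₁ (++⁻ˡ (varsT t₁) h)) (substT-cong t₂ (++⁻ʳ (varsT t₁) h))

  substCs-cong : ∀ {σ σ′} cs → σ ≗ σ′ on List.concatMap varsC cs → substCs σ cs ≡ substCs σ′ cs
  substCs-cong [] _ = refl
  substCs-cong (c ∷ cs) h = cong₂ _∷_ (substC-cong c (++⁻ˡ (varsC c) h)) (substCs-cong cs (++⁻ʳ (varsC c) h))

  mutual
    substT-⌜⌝ : ∀ σ r → substT σ ⌜ r ⌝ ≡ ⌜ r ⌝
    substT-⌜⌝ σ (num n) = refl
    substT-⌜⌝ σ (con c) = refl
    substT-⌜⌝ σ inf = refl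
    substT-⌜⌝ σ sup = refl
    substT-⌜⌝ σ (fn f (r ∷ rs)) = cong₂ (λ a b → fn f (a ∷ b)) (substT-⌜⌝ σ r) (substL-⌜⌝ σ rs)

    substL-⌜⌝ : ∀ σ rs → substL σ ⌜ rs ⌝L ≡ ⌜ rs ⌝L
    substL-⌜⌝ σ [] = refl
    substL-⌜⌝ σ (r ∷ rs) = cong₂ _∷_ (substT-⌜⌝ σ r) (substL-⌜⌝ σ rs)

  mutual
    varsT-⌜⌝ : ∀ r → varsT ⌜ r ⌝ ≡ []
    varsT-⌜⌝ (num n) = refl
    varsT-⌜⌝ (con c) = refl
    varsT-⌜⌝ inf = refl
    varsT-⌜⌝ sup = refl
    varsT-⌜⌝ (fn f (r ∷ rs)) = cong₂ _++_ (varsT-⌜⌝ r) (varsL-⌜⌝ rs)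

    varsL-⌜⌝ : ∀ rs → varsL ⌜ rs ⌝L ≡ []
    varsL-⌜⌝ [] = refl
    varsL-⌜⌝ (r ∷ rs) = cong₂ _++_ (varsT-⌜⌝ r) (varsL-⌜⌝ rs)

  mutual
    vals-⌜⌝ : ∀ r → vals ⌜ r ⌝ r
    vals-⌜⌝ (num n) = refl
    vals-⌜⌝ (con c) = refl
    vals-⌜⌝ inf = refl
    vals-⌜⌝ sup = refl
    vals-⌜⌝ (fn f (r ∷ rs)) = r , rs , refl , vals-⌜⌝ r , valsL-⌜⌝ rs

    valsL-⌜⌝ : ∀ rs → valsL ⌜ rs ⌝L rs
    valsL-⌜⌝ [] = tt
    valsL-⌜⌝ (r ∷ rs) = vals-⌜⌝ r , valsL-⌜⌝ rs

  mutual
    vals-⌜⌝-unique : ∀ r {y} → vals ⌜ r ⌝ y → y ≡ r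
    vals-⌜⌝-unique (num n) v = v
    vals-⌜⌝-unique (con c) v = v
    vals-⌜⌝-unique inf v = v
    vals-⌜⌝-unique sup v = v
    vals-⌜⌝-unique (fn f (r ∷ rs)) (_ , _ , refl , v , vs) =
      cong₂ (λ a b → fn f (a ∷ b)) (vals-⌜⌝-unique r v) (valsL-⌜⌝-unique rs vs)

    valsL-⌜⌝-unique : ∀ rs {ys} → valsL ⌜ rs ⌝L ys → ys ≡ rs
    valsL-⌜⌝-unique [] {[]} _ = refl
    valsL-⌜⌝-unique (r ∷ rs) {y ∷ ys} (v , vs) = cong₂ _∷_ (vals-⌜⌝-unique r v) (valsL-⌜⌝-unique rs vs)

  length-valsL : ∀ ts {rs} → valsL ts rs → length rs ≡ length ts
  length-valsL [] {[]} _ = refl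
  length-valsL (t ∷ ts) {r ∷ rs} (_ , v) = cong suc (length-valsL ts v)

  length-substL : ∀ {σ} ts → length (substL σ ts) ≡ length ts
  length-substL [] = refl
  length-substL (t ∷ ts) = cong suc (length-substL ts)

  -- the composite of σ₁ and σ₂: the values of σ₁ are closed, so σ₂ need not act on them
  _⨾_ : Sub → Sub → Sub
  (σ₁ ⨾ σ₂) x = maybe just (σ₂ x) (σ₁ x)

  mutual
    substT-⨾ : ∀ σ₁ σ₂ t → substT σ₂ (substT σ₁ t) ≡ substT (σ₁ ⨾ σ₂) t
    substT-⨾ σ₁ σ₂ (num n) = refl
    substT-⨾ σ₁ σ₂ (con c) = refl
    substT-⨾ σ₁ σ₂ (var x) with σ₁ x
    ... | just r = substT-⌜⌝ σ₂ r
    ... | nothing = refl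
    substT-⨾ σ₁ σ₂ inf = refl
    substT-⨾ σ₁ σ₂ sup = refl
    substT-⨾ σ₁ σ₂ (fn f (t ∷ ts)) = cong₂ (λ a b → fn f (a ∷ b)) (substT-⨾ σ₁ σ₂ t) (substL-⨾ σ₁ σ₂ ts)
    substT-⨾ σ₁ σ₂ (op o ts) = cong (op o) (substV-⨾ σ₁ σ₂ ts)
    substT-⨾ σ₁ σ₂ (rng t₁ t₂) = cong₂ rng (substT-⨾ σ₁ σ₂ t₁) (substT-⨾ σ₁ σ₂ t₂)

    substL-⨾ : ∀ σ₁ σ₂ ts → substL σ₂ (substL σ₁ ts) ≡ substL (σ₁ ⨾ σ₂) ts
    substL-⨾ σ₁ σ₂ [] = refl
    substL-⨾ σ₁ σ₂ (t ∷ ts) = cong₂ _∷_ (substT-⨾ σ₁ σ₂ t) (substL-⨾ σ₁ σ₂ ts)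

    substV-⨾ : ∀ {n} σ₁ σ₂ (ts : Vec Term n) → substV σ₂ (substV σ₁ ts) ≡ substV (σ₁ ⨾ σ₂) ts
    substV-⨾ σ₁ σ₂ [] = refl
    substV-⨾ σ₁ σ₂ (t ∷ ts) = cong₂ _∷_ (substT-⨾ σ₁ σ₂ t) (substV-⨾ σ₁ σ₂ ts)

  substCs-⨾ : ∀ σ₁ σ₂ cs → substCs σ₂ (substCs σ₁ cs) ≡ substCs (σ₁ ⨾ σ₂) cs
  substCs-⨾ σ₁ σ₂ [] = refl
  substCs-⨾ σ₁ σ₂ (c ∷ cs) = cong₂ _∷_ (substC-⨾ c) (substCs-⨾ σ₁ σ₂ cs)
    where
      substC-⨾ : ∀ c → substC σ₂ (substC σ₁ c) ≡ substC (σ₁ ⨾ σ₂) c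
      substC-⨾ (clit (pos p ts)) = cong (clit ∘ pos p) (substL-⨾ σ₁ σ₂ ts)
      substC-⨾ (clit (neg p ts)) = cong (clit ∘ neg p) (substL-⨾ σ₁ σ₂ ts)
      substC-⨾ (ccmp ≺ t₁ t₂) = cong₂ (ccmp ≺) (substT-⨾ σ₁ σ₂ t₁) (substT-⨾ σ₁ σ₂ t₂)

  mutual
    varsT-substT : ∀ σ {x} t → x ∈ varsT (substT σ t) → (σ x ≡ nothing) × (x ∈ varsT t)
    varsT-substT σ (num n) ()
    varsT-substT σ (con c) ()
    varsT-substT σ (var y) m with σ y in e
    ... | just r = ⊥-elim (∉[] (subst (_ ∈_) (varsT-⌜⌝ r) m))
    varsT-substT σ (var y) (here refl) | nothing = e , here refl
    varsT-substT σ inf ()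
    varsT-substT σ sup ()
    varsT-substT σ (fn f (t ∷ ts)) m =
      [ map₂ ∈-++⁺ˡ ∘ varsT-substT σ t , map₂ (∈-++⁺ʳ _) ∘ varsL-substL σ ts ]′ (∈-++⁻ _ m)
    varsT-substT σ (op o ts) m = varsV-substV σ ts m
    varsT-substT σ (rng t₁ t₂) m =
      [ map₂ ∈-++⁺ˡ ∘ varsT-substT σ t₁ , map₂ (∈-++⁺ʳ _) ∘ varsT-substT σ t₂ ]′ (∈-++⁻ _ m)

    varsL-substL : ∀ σ {x} ts → x ∈ varsL (substL σ ts) → (σ x ≡ nothing) × (x ∈ varsL ts)
    varsL-substL σ [] ()
    varsL-substL σ (t ∷ ts) m =
      [ map₂ ∈-++⁺ˡ ∘ varsT-substT σ t , map₂ (∈-++⁺ʳ _) ∘ varsL-substL σ ts ]′ (∈-++⁻ _ m)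

    varsV-substV : ∀ {n} σ {x} (ts : Vec Term n) → x ∈ varsV (substV σ ts) → (σ x ≡ nothing) × (x ∈ varsV ts)
    varsV-substV σ [] ()
    varsV-substV σ (t ∷ ts) m =
      [ map₂ ∈-++⁺ˡ ∘ varsT-substT σ t , map₂ (∈-++⁺ʳ _) ∘ varsV-substV σ ts ]′ (∈-++⁻ _ m)

  varsCs-substCs : ∀ σ {x} cs → x ∈ List.concatMap varsC (substCs σ cs) →
                   (σ x ≡ nothing) × (x ∈ List.concatMap varsC cs)
  varsCs-substCs σ [] ()
  varsCs-substCs σ (c ∷ cs) m =
    [ map₂ ∈-++⁺ˡ ∘ varsC-substC c , map₂ (∈-++⁺ʳ _) ∘ varsCs-substCs σ cs ]′ (∈-++⁻ _ m)
    where
      varsC-substC : ∀ {x} c → x ∈ varsC (substC σ c) → (σ x ≡ nothing) × (x ∈ varsC c)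
      varsC-substC (clit (pos p ts)) = varsL-substL σ ts
      varsC-substC (clit (neg p ts)) = varsL-substL σ ts
      varsC-substC (ccmp ≺ t₁ t₂) m =
        [ map₂ ∈-++⁺ˡ ∘ varsT-substT σ t₁ , map₂ (∈-++⁺ʳ _) ∘ varsT-substT σ t₂ ]′ (∈-++⁻ _ m)

  varsAggLeft-subst : ∀ σ {x} ts cs → x ∈ varsAggLeft (substT⁺ σ ts) (substCs σ cs) →
                      (σ x ≡ nothing) × (x ∈ varsAggLeft ts cs)
  varsAggLeft-subst σ (t ∷ ts) cs m =
    [ [ map₂ (∈-++⁺ˡ ∘ ∈-++⁺ˡ) ∘ varsT-substT σ t
      , map₂ (∈-++⁺ˡ ∘ ∈-++⁺ʳ (varsT t)) ∘ varsL-substL σ ts ]′ ∘ ∈-++⁻ _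
    , map₂ (∈-++⁺ʳ _) ∘ varsCs-substCs σ cs ]′ (∈-++⁻ _ m)

  substL-resubst : ∀ σ₁ σ₂ θ ts → σ₂ ≗ θ on varsL (substL σ₁ ts) → (∀ x → (σ₁ ⨾ θ) x ≡ θ x) →
                   substL σ₂ (substL σ₁ ts) ≡ substL θ ts
  substL-resubst σ₁ σ₂ θ ts σ₂≗θ θ-absorbs = begin
    substL σ₂ (substL σ₁ ts)  ≡⟨ substL-cong (substL σ₁ ts) σ₂≗θ ⟩
    substL θ (substL σ₁ ts)   ≡⟨ substL-⨾ σ₁ θ ts ⟩
    substL (σ₁ ⨾ θ) ts        ≡⟨ substL-cong ts (All.universal θ-absorbs _) ⟩
    substL θ ts               ∎
    where open ≡-Reasoning

  substCs-resubst : ∀ σ₁ σ₂ θ cs → σ₂ ≗ θ on List.concatMap varsC (substCs σ₁ cs) →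
                    (∀ x → (σ₁ ⨾ θ) x ≡ θ x) →
                    substCs σ₂ (substCs σ₁ cs) ≡ substCs θ cs
  substCs-resubst σ₁ σ₂ θ cs σ₂≗θ θ-absorbs = begin
    substCs σ₂ (substCs σ₁ cs)  ≡⟨ substCs-cong (substCs σ₁ cs) σ₂≗θ ⟩
    substCs θ (substCs σ₁ cs)   ≡⟨ substCs-⨾ σ₁ θ cs ⟩
    substCs (σ₁ ⨾ θ) cs         ≡⟨ substCs-cong cs (All.universal θ-absorbs _) ⟩
    substCs θ cs                ∎
    where open ≡-Reasoning

  assoc-map : ∀ xs (g : PV → PTerm) {x} → x ∈ xs → assoc xs (List.map g xs) x ≡ just (g x)
  assoc-map (y ∷ ys) g {x} m with x ≟V y
  ... | yes refl = refl
  assoc-map (y ∷ ys) g (here x≡y) | no x≢y = ⊥-elim (x≢y x≡y)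
  assoc-map (y ∷ ys) g (there m)  | no _   = assoc-map ys g m

  assoc-defined : ∀ xs rs {x} → length rs ≡ length xs → x ∈ xs → Σ PTerm λ r → assoc xs rs x ≡ just r
  assoc-defined (y ∷ ys) (r ∷ rs) {x} e m with x ≟V y
  ... | yes _ = r , refl
  assoc-defined (y ∷ ys) (r ∷ rs) e (here x≡y) | no x≢y = ⊥-elim (x≢y x≡y)
  assoc-defined (y ∷ ys) (r ∷ rs) e (there m)  | no _   = assoc-defined ys rs (cong ℕ.pred e) m

  Assigns : Env → List Var → List PTerm → Set
  Assigns ρ = Pointwise (λ X r → ρ X ≡ r)

  [↦]-hit : ∀ ρ X r → (ρ [ X ↦ r ]) X ≡ r
  [↦]-hit ρ X r with X ≟Var X
  ... | yes _ = refl
  ... | no X≢X = ⊥-elim (X≢X refl)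

  [↦]-miss : ∀ ρ X r {Y} → Y ≢ X → (ρ [ X ↦ r ]) Y ≡ ρ Y
  [↦]-miss ρ X r {Y} Y≢X with Y ≟Var X
  ... | yes Y≡X = ⊥-elim (Y≢X Y≡X)
  ... | no _ = refl

  updates-miss : ∀ ρ Xs rs {Y} → Y ∉ Xs → updates ρ Xs rs Y ≡ ρ Y
  updates-miss ρ [] rs _ = refl
  updates-miss ρ (X ∷ Xs) [] _ = refl
  updates-miss ρ (X ∷ Xs) (r ∷ rs) Y∉ =
    trans (updates-miss (ρ [ X ↦ r ]) Xs rs (Y∉ ∘ there)) ([↦]-miss ρ X r (Y∉ ∘ here))

  updates-assigns : ∀ ρ Xs rs → Unique Xs → length rs ≡ length Xs → Assigns (updates ρ Xs rs) Xs rs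
  updates-assigns ρ [] [] _ _ = []
  updates-assigns ρ (X ∷ Xs) (r ∷ rs) (X∉ ∷ u) e =
    trans (updates-miss (ρ [ X ↦ r ]) Xs rs (All¬⇒¬Any X∉)) ([↦]-hit ρ X r)
    ∷ updates-assigns (ρ [ X ↦ r ]) Xs rs u (cong ℕ.pred e)

  updates-map : ∀ ρ Xs (g : Var → PTerm) {Y} → Unique Xs → Y ∈ Xs → updates ρ Xs (List.map g Xs) Y ≡ g Y
  updates-map ρ (X ∷ Xs) g (X∉ ∷ _) (here refl) =
    trans (updates-miss (ρ [ X ↦ g X ]) Xs (List.map g Xs) (All¬⇒¬Any X∉)) ([↦]-hit ρ X (g X))
  updates-map ρ (X ∷ Xs) g (_ ∷ u) (there m) = updates-map (ρ [ X ↦ g X ]) Xs g u m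

  Assigns-updates : ∀ {ρ Us rs} Vs ws → (∀ {U} → U ∈ Us → U ∉ Vs) →
                    Assigns ρ Us rs → Assigns (updates ρ Vs ws) Us rs
  Assigns-updates Vs ws disj [] = []
  Assigns-updates Vs ws disj (e ∷ es) =
    trans (updates-miss _ Vs ws (disj (here refl))) e ∷ Assigns-updates Vs ws (disj ∘ there) es

  substL-progSub-updates : ∀ ρ Xs rs ts → (∀ x → prog x ∉ Xs) →
                           substL (progSub (updates ρ Xs rs)) ts ≡ substL (progSub ρ) ts
  substL-progSub-updates ρ Xs rs ts prog∉ =
    substL-cong ts (All.universal (λ x → cong just (updates-miss ρ Xs rs (prog∉ x))) _)

  evalL-varA : ∀ {I ρ Xs rs} → Assigns ρ Xs rs → evalL I (List.map varA Xs) ρ ≡ rs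
  evalL-varA [] = refl
  evalL-varA (e ∷ es) = cong₂ _∷_ e (evalL-varA es)

  fresh-unique : ∀ (v : ℕ → Var) → (∀ {i j} → v i ≡ v j → i ≡ j) → ∀ n → Unique (fresh v n)
  fresh-unique v v-injective n = Unique.map⁺ v-injective (Unique.upTo⁺ n)

  length-fresh : ∀ (v : ℕ → Var) n → length (fresh v n) ≡ n
  length-fresh v n = trans (length-map v (List.upTo n)) (length-upTo n)

  prog∉fresh : ∀ (v : ℕ → Var) {x} n → (∀ i → v i ≢ prog x) → prog x ∉ fresh v n
  prog∉fresh v n v≢prog m with i , _ , e ← ∈-map⁻ v m = v≢prog i (sym e)

  -- the new variables 𝐙 of the representation of an aggregate whose tuple 𝐭 has length 1 + n
  aggTupleVars⁺ : ℕ → List⁺ Var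
  aggTupleVars⁺ n = vZ 0 ∷ fresh (λ i → vZ (suc i)) n

  aggTupleVars : ℕ → List Var
  aggTupleVars n = toList (aggTupleVars⁺ n)

  aggTupleVars-unique : ∀ n → Unique (aggTupleVars n)
  aggTupleVars-unique n =
    All-map⁺ (All.universal (λ _ ()) _) ∷ fresh-unique (λ i → vZ (suc i)) (λ { refl → refl }) n

  aggTupleVars-vZ : ∀ {U} n → U ∈ aggTupleVars n → Σ ℕ λ i → U ≡ vZ i
  aggTupleVars-vZ n (here e) = 0 , e
  aggTupleVars-vZ n (there m) with i , _ , e ← ∈-map⁻ (λ i → vZ (suc i)) m = suc i , e

  aggTupleVars-disjoint-prog : ∀ {U} n xs → U ∈ aggTupleVars n → U ∉ List.map prog xs
  aggTupleVars-disjoint-prog n xs m m′ with aggTupleVars-vZ n m | ∈-map⁻ prog m′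
  ... | _ , refl | _ , _ , ()

  open DecMembership _≟V_ using () renaming (_∈?_ to _∈V?_)
  open DecMembership _≟Var_ using () renaming (_∈?_ to _∈Var?_)

  instanceSub : Rule → (PV → PTerm) → Sub
  instanceSub R ρ x = if does (x ∈V? globals R) then just (ρ x) else nothing

  instanceSub-global : ∀ R ρ {x} → x ∈ globals R → instanceSub R ρ x ≡ just (ρ x)
  instanceSub-global R ρ {x} m rewrite dec-true (x ∈V? globals R) m = refl

  instanceSub-nothing : ∀ R ρ {x} → instanceSub R ρ x ≡ nothing → x ∉ globals R
  instanceSub-nothing R ρ e m with () ← trans (sym e) (instanceSub-global R ρ m)

  aggVars : Rule → List PV
  aggVars R = List.concatMap aggVarsB (body R)

  local⇒¬global : ∀ R {x} → x ∈ locals R → x ∉ globals R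
  local⇒¬global R m =
    proj₂ (∈-filter⁻ (λ x → ¬? (x ∈V? globals R)) {xs = aggVars R} (∈-deduplicate⁻ _≟V_ _ m))

  aggVar⇒local : ∀ R {x} → x ∈ aggVars R → x ∉ globals R → x ∈ locals R
  aggVar⇒local R m ¬g = ∈-deduplicate⁺ _≟V_ (∈-filter⁺ (λ x → ¬? (x ∈V? globals R)) m ¬g)

  globalsB⊆globals : ∀ R {b x} → b ∈ body R → x ∈ globalsB b → x ∈ globals R
  globalsB⊆globals R b∈ m = ∈-deduplicate⁺ _≟V_ (∈-++⁺ʳ (headVars′ R) (∈-concatMap⁺ globalsB (lose b∈ m)))

  aggVarsB⊆aggVars : ∀ R {b x} → b ∈ body R → x ∈ aggVarsB b → x ∈ aggVars R
  aggVarsB⊆aggVars R b∈ m = ∈-concatMap⁺ aggVarsB (lose b∈ m)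

  head⊆globals : ∀ R {x} → x ∈ headVars′ R → x ∈ globals R
  head⊆globals R m = ∈-deduplicate⁺ _≟V_ (∈-++⁺ˡ m)

  prog-injective : ∀ {x y} → prog x ≡ prog y → x ≡ y
  prog-injective refl = refl

  progLocals-unique : ∀ R → Unique (List.map prog (locals R))
  progLocals-unique R = Unique.map⁺ prog-injective (UniqueDec.deduplicate-! _≟V_ _)

  prog-global∉progLocals : ∀ R {x} → x ∈ globals R → prog x ∉ List.map prog (locals R)
  prog-global∉progLocals R g m =
    let _ , m′ , e = ∈-map⁻ prog m in local⇒¬global R (subst (_∈ locals R) (sym (prog-injective e)) m′) g

  fv-∧ˡ : ∀ {X} F G → X ∈ fvF F → X ∈ fvF (F ∧F G)
  fv-∧ˡ F G m = ∈-++⁺ˡ (∈-++⁺ˡ m)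

  fv-∧ʳ : ∀ {X} F G → X ∈ fvF G → X ∈ fvF (F ∧F G)
  fv-∧ʳ F G m = ∈-++⁺ˡ (∈-++⁺ʳ (fvF F) (∈-++⁺ˡ m))

  fv-⋀-∷ˡ : ∀ {X} F Fs → X ∈ fvF F → X ∈ fvF (⋀F (F ∷ Fs))
  fv-⋀-∷ˡ F [] m = m
  fv-⋀-∷ˡ F (G ∷ Gs) m = fv-∧ˡ F (⋀F (G ∷ Gs)) m

  fv-⋀-∷ʳ : ∀ {X} F Fs → X ∈ fvF (⋀F Fs) → X ∈ fvF (⋀F (F ∷ Fs))
  fv-⋀-∷ʳ F [] ()
  fv-⋀-∷ʳ F (G ∷ Gs) m = fv-∧ʳ F (⋀F (G ∷ Gs)) m

  fv-⋀ : ∀ {X F} Fs → F ∈ Fs → X ∈ fvF F → X ∈ fvF (⋀F Fs)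
  fv-⋀ (F ∷ Fs) (here refl) = fv-⋀-∷ˡ F Fs
  fv-⋀ (F ∷ Fs) (there F∈) m = fv-⋀-∷ʳ F Fs (fv-⋀ Fs F∈ m)

  fv-exF : ∀ {Y} X F → Y ≢ X → Y ∈ fvF F → Y ∈ fvF (exF X F)
  fv-exF X F Y≢X m = ∈-++⁺ˡ (∈-filter⁺ (λ Y → ¬? (Y ≟Var X)) (∈-++⁺ˡ m) Y≢X)

  fv-∃⃗ : ∀ {Y} Xs F → Y ∉ Xs → Y ∈ fvF F → Y ∈ fvF (∃⃗ Xs F)
  fv-∃⃗ [] F _ m = m
  fv-∃⃗ (X ∷ Xs) F Y∉ m = fv-exF X (∃⃗ Xs F) (Y∉ ∘ here) (fv-∃⃗ Xs F (Y∉ ∘ there) m)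

  fv-memAll : ∀ {x} Xs ts → length Xs ≡ length ts → x ∈ varsL ts → prog x ∈ fvF (memAll Xs ts)
  fv-memAll (X ∷ Xs) (t ∷ ts) e m with ∈-++⁻ (varsT t) m
  ... | inj₁ m′ = fv-⋀-∷ˡ (memF (varA X) t) (List.zipWith (λ X t → memF (varA X) t) Xs ts)
                    (there (∈-map⁺ prog m′))
  ... | inj₂ m′ = fv-⋀-∷ʳ (memF (varA X) t) (List.zipWith (λ X t → memF (varA X) t) Xs ts)
                    (fv-memAll Xs ts (cong ℕ.pred e) m′)

  literalVars : List Term → List Var
  literalVars ts = fresh vL (length ts)

  literalVars-unique : ∀ ts → Unique (literalVars ts)
  literalVars-unique ts = fresh-unique vL (λ { refl → refl }) (length ts)

  prog∉literalVars : ∀ ts x → prog x ∉ literalVars ts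
  prog∉literalVars ts x = prog∉fresh vL (length ts) (λ _ ())

  fv-φLit : ∀ {x} l → x ∈ varsLit l → prog x ∈ fvF (φLit l)
  fv-φLit {x} (pos p ts) m =
    fv-∃⃗ Ls _ (prog∉literalVars ts x)
      (fv-∧ˡ (memAll Ls ts) (atomF p (List.map varA Ls)) (fv-memAll Ls ts (length-fresh vL (length ts)) m))
    where Ls = literalVars ts
  fv-φLit {x} (neg p ts) m =
    fv-∃⃗ Ls _ (prog∉literalVars ts x)
      (fv-∧ˡ (memAll Ls ts) (¬F (atomF p (List.map varA Ls))) (fv-memAll Ls ts (length-fresh vL (length ts)) m))
    where Ls = literalVars ts

  fv-φCmp : ∀ {x} ≺ t₁ t₂ → x ∈ varsT t₁ ++ varsT t₂ → prog x ∈ fvF (φCmp ≺ t₁ t₂)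
  fv-φCmp ≺ t₁ t₂ m =
    fv-exF (vL 0) (exF (vL 1) (⋀F Fs)) (λ ()) (fv-exF (vL 1) (⋀F Fs) (λ ())
      ([ (λ m₁ → fv-⋀ Fs (here refl) (there (∈-map⁺ prog m₁)))
       , (λ m₂ → fv-⋀ Fs (there (here refl)) (there (∈-map⁺ prog m₂))) ]′ (∈-++⁻ (varsT t₁) m)))
    where Fs = memF (varA (vL 0)) t₁ ∷ memF (varA (vL 1)) t₂ ∷ cmpF ≺ (varA (vL 0)) (varA (vL 1)) ∷ []

  fv-φB : ∀ {x} Ls b → x ∈ globalsB b → prog x ∈ fvF (φB Ls b)
  fv-φB Ls (blit l) m = fv-φLit l m
  fv-φB Ls (bcmp ≺ t₁ t₂) m = fv-φCmp ≺ t₁ t₂ m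
  fv-φB Ls (bagg α (t ∷ ts) cs ≺ (inj₁ y)) (here refl) =
    fv-exF vY (C ∧F memF (varA vY) (var y)) (λ ()) (fv-∧ʳ C (memF (varA vY) (var y)) (there (here refl)))
    where
      Zs = aggTupleVars⁺ (length ts)
      C = cmpF ≺ (aggA α Zs (∃⃗ (List.map prog Ls) (memAll (toList Zs) (t ∷ ts) ∧F φCs cs))) (varA vY)

  fv-φBody : ∀ {x} Ls bs → x ∈ List.concatMap globalsB bs → prog x ∈ fvF (φBody Ls bs)
  fv-φBody Ls bs m with b , b∈ , m′ ← find (∈-concatMap⁻ globalsB {xs = bs} m) =
    fv-⋀ (List.map (φB Ls) bs) (∈-map⁺ (φB Ls) b∈) (fv-φB Ls b m′)

  fv-head∪body : ∀ {x} Xs ts Ls bs → length Xs ≡ length ts → x ∈ dedupV (varsL ts ++ List.concatMap globalsB bs) →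
                 prog x ∈ fvF (memAll Xs ts) ⊎ prog x ∈ fvF (φBody Ls bs)
  fv-head∪body Xs ts Ls bs e g =
    Sum.map (fv-memAll Xs ts e) (fv-φBody Ls bs) (∈-++⁻ (varsL ts) (∈-deduplicate⁻ _≟V_ _ g))

  fv-repAnte-basic : ∀ {x} Vs p ts bs → length Vs ≡ length ts → x ∈ globals (basic p ts bs) →
                     prog x ∈ fvF (repAnte Vs (basic p ts bs))
  fv-repAnte-basic Vs p ts bs e g =
    [ fv-∧ˡ (memAll Vs ts) B , fv-∧ʳ (memAll Vs ts) B ]′ (fv-head∪body Vs ts (locals (basic p ts bs)) bs e g)
    where B = φBody (locals (basic p ts bs)) bs

  fv-repAnte-choice : ∀ {x} Vs p ts bs → length Vs ≡ length ts → x ∈ globals (choice p ts bs) →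
                      prog x ∈ fvF (repAnte Vs (choice p ts bs))
  fv-repAnte-choice Vs p ts bs e g =
    [ fv-⋀ Fs (here refl) , fv-⋀ Fs (there (here refl)) ]′ (fv-head∪body Vs ts (locals (choice p ts bs)) bs e g)
    where Fs = memAll Vs ts ∷ φBody (locals (choice p ts bs)) bs ∷ atomF p (List.map varA Vs) ∷ []

  completionVars : List Var → Rule → List Var
  completionVars Vs R = dedupVar (List.filter (λ Y → ¬? (Y ∈Var? Vs)) (fvF (repAnte Vs R)))

  completionVars-unique : ∀ Vs R → Unique (completionVars Vs R)
  completionVars-unique Vs R = UniqueDec.deduplicate-! _≟Var_ _

  completionVars-disjoint : ∀ Vs R {V} → V ∈ Vs → V ∉ completionVars Vs R
  completionVars-disjoint Vs R V∈ m =
    proj₂ (∈-filter⁻ (λ Y → ¬? (Y ∈Var? Vs)) {xs = fvF (repAnte Vs R)} (∈-deduplicate⁻ _≟Var_ _ m)) V∈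

  fv⇒completionVar : ∀ Vs R {Y} → Y ∈ fvF (repAnte Vs R) → Y ∉ Vs → Y ∈ completionVars Vs R
  fv⇒completionVar Vs R m Y∉ = ∈-deduplicate⁺ _≟Var_ (∈-filter⁺ (λ Y → ¬? (Y ∈Var? Vs)) m Y∉)

  ⌊⌋-∧⁺ : ∀ {P Q : Set} (p? : Dec P) (q? : Dec Q) → P → Q → (⌊ p? ⌋ ∧ ⌊ q? ⌋) ≡ true
  ⌊⌋-∧⁺ (yes _) (yes _) _ _ = refl
  ⌊⌋-∧⁺ (yes _) (no ¬q) _ q = ⊥-elim (¬q q)
  ⌊⌋-∧⁺ (no ¬p) _ p _ = ⊥-elim (¬p p)

  ⌊⌋-∧⁻ : ∀ {P Q : Set} (p? : Dec P) (q? : Dec Q) → (⌊ p? ⌋ ∧ ⌊ q? ⌋) ≡ true → P × Q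
  ⌊⌋-∧⁻ (yes p) (yes q) _ = p , q
  ⌊⌋-∧⁻ (yes _) (no _) ()
  ⌊⌋-∧⁻ (no _) _ ()

  ∈-definition⁺ : ∀ pn Γ {R} → R ∈ Γ → inDefinition pn R ≡ true → R ∈ definition Γ pn
  ∈-definition⁺ pn (R ∷ Γ) (here refl) e rewrite e = here refl
  ∈-definition⁺ pn (R′ ∷ Γ) (there m) e with inDefinition pn R′
  ... | true = there (∈-definition⁺ pn Γ m e)
  ... | false = ∈-definition⁺ pn Γ m e

  ∈-definition⁻ : ∀ pn Γ {R} → R ∈ definition Γ pn → R ∈ Γ × inDefinition pn R ≡ true
  ∈-definition⁻ pn (R′ ∷ Γ) m with inDefinition pn R′ in e
  ∈-definition⁻ pn (R′ ∷ Γ) (here refl) | true = here refl , e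
  ∈-definition⁻ pn (R′ ∷ Γ) (there m)   | true = Product.map₁ there (∈-definition⁻ pn Γ m)
  ∈-definition⁻ pn (R′ ∷ Γ) m           | false = Product.map₁ there (∈-definition⁻ pn Γ m)

  module _ (em : ExcludedMiddle (lsuc lzero)) where

    dec : (P : Set) → Dec P
    dec P = map′ lower lift em

    ¬¬-elim : {P : Set} → ¬ ¬ P → P
    ¬¬-elim = decidable-stable (dec _)

    _∖_ : Interp → Atom → Interp
    (J ∖ a) a′ = J a′ × a′ ≢ a

    module _ (I : Interp) where

      ∧F-intro : ∀ F G {ρ} → truth I F ρ → truth I G ρ → truth I (F ∧F G) ρ
      ∧F-intro F G f g k = k f g

      ∧F-elim : ∀ F G {ρ} → truth I (F ∧F G) ρ → truth I F ρ × truth I G ρ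
      ∧F-elim F G h = ¬¬-elim (λ ¬f → h (λ f _ → ¬f f)) , ¬¬-elim (λ ¬g → h (λ _ g → ¬g g))

      ⋀F-∷-intro : ∀ F Fs {ρ} → truth I F ρ → truth I (⋀F Fs) ρ → truth I (⋀F (F ∷ Fs)) ρ
      ⋀F-∷-intro F [] f _ = f
      ⋀F-∷-intro F (G ∷ Gs) f fs = ∧F-intro F (⋀F (G ∷ Gs)) f fs

      ⋀F-∷-elim : ∀ F Fs {ρ} → truth I (⋀F (F ∷ Fs)) ρ → truth I F ρ × truth I (⋀F Fs) ρ
      ⋀F-∷-elim F [] f = f , λ ()
      ⋀F-∷-elim F (G ∷ Gs) h = ∧F-elim F (⋀F (G ∷ Gs)) h

      ⋁F-intro : ∀ Fs {ρ} → Any (λ F → truth I F ρ) Fs → truth I (⋁F Fs) ρ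
      ⋁F-intro (F ∷ []) (here f) = f
      ⋁F-intro (F ∷ G ∷ Gs) (here f) ¬f = ⊥-elim (¬f f)
      ⋁F-intro (F ∷ G ∷ Gs) (there fs) _ = ⋁F-intro (G ∷ Gs) fs

      ⋁F-elim : ∀ Fs {ρ} → truth I (⋁F Fs) ρ → Any (λ F → truth I F ρ) Fs
      ⋁F-elim (F ∷ []) f = here f
      ⋁F-elim (F ∷ G ∷ Gs) {ρ} h =
        [ here , (λ ¬f → there (⋁F-elim (G ∷ Gs) (h ¬f))) ]′ (toSum (dec (truth I F ρ)))

      exF-intro : ∀ X F {ρ} r → truth I F (ρ [ X ↦ r ]) → truth I (exF X F) ρ
      exF-intro X F r f ∀¬ = ∀¬ r f

      exF-elim : ∀ X F {ρ} → truth I (exF X F) ρ → Σ PTerm λ r → truth I F (ρ [ X ↦ r ])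
      exF-elim X F h = ¬¬-elim (λ ∄ → h (λ r f → ∄ (r , f)))

      ∃⃗-intro : ∀ F Xs rs {ρ} → length rs ≡ length Xs → truth I F (updates ρ Xs rs) → truth I (∃⃗ Xs F) ρ
      ∃⃗-intro F [] [] _ f = f
      ∃⃗-intro F (X ∷ Xs) (r ∷ rs) e f = exF-intro X (∃⃗ Xs F) r (∃⃗-intro F Xs rs (cong ℕ.pred e) f)

      ∃⃗-elim : ∀ F Xs {ρ} → truth I (∃⃗ Xs F) ρ →
               Σ (List PTerm) λ rs → (length rs ≡ length Xs) × truth I F (updates ρ Xs rs)
      ∃⃗-elim F [] f = [] , refl , f
      ∃⃗-elim F (X ∷ Xs) h =
        let (r , f) = exF-elim X (∃⃗ Xs F) h
            (rs , e , f′) = ∃⃗-elim F Xs f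
        in r ∷ rs , cong suc e , f′

      ∀⃗-intro : ∀ F Xs {ρ} → (∀ rs → length rs ≡ length Xs → truth I F (updates ρ Xs rs)) →
                truth I (∀⃗ Xs F) ρ
      ∀⃗-intro F [] h = h [] refl
      ∀⃗-intro F (X ∷ Xs) h r = ∀⃗-intro F Xs (λ rs e → h (r ∷ rs) (cong suc e))

      memAll-intro : ∀ {ρ Xs rs} ts → Assigns ρ Xs rs → valsL (substL (progSub ρ) ts) rs → truth I (memAll Xs ts) ρ
      memAll-intro [] [] _ = λ ()
      memAll-intro {ρ} {X ∷ Xs} (t ∷ ts) (e ∷ es) (v , vs) =
        ⋀F-∷-intro (memF (varA X) t) (List.zipWith (λ X t → memF (varA X) t) Xs ts)
          (subst (vals (substT (progSub ρ) t)) (sym e) v) (memAll-intro ts es vs)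

      memAll-elim : ∀ {ρ Xs rs} ts → Assigns ρ Xs rs → length Xs ≡ length ts →
                    truth I (memAll Xs ts) ρ → valsL (substL (progSub ρ) ts) rs
      memAll-elim [] [] _ _ = tt
      memAll-elim {ρ} {X ∷ Xs} (t ∷ ts) (e ∷ es) l h =
        let (v , vs) = ⋀F-∷-elim (memF (varA X) t) (List.zipWith (λ X t → memF (varA X) t) Xs ts) h
        in subst (vals (substT (progSub ρ) t)) e v , memAll-elim ts es (cong ℕ.pred l) vs

      HoldsLit : Lit → Set
      HoldsLit (pos p ts) = Σ (List PTerm) λ rs → valsL ts rs × I (p , rs)
      HoldsLit (neg p ts) = Σ (List PTerm) λ rs → valsL ts rs × ¬ I (p , rs)

      HoldsCmp : Rel → Term → Term → Set
      HoldsCmp ≺ t₁ t₂ = Σ PTerm λ r₁ → Σ PTerm λ r₂ → vals t₁ r₁ × vals t₂ r₂ × ⟦ ≺ ⟧ʳ r₁ r₂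

      HoldsC : CElem → Set
      HoldsC (clit l) = HoldsLit l
      HoldsC (ccmp ≺ t₁ t₂) = HoldsCmp ≺ t₁ t₂

      HoldsCs : List CElem → Set
      HoldsCs = All HoldsC

      HoldsLit⇒⊨τLit : ∀ l → HoldsLit l → I ⊨ τLit l
      HoldsLit⇒⊨τLit (pos p ts) (rs , v , a) = lift (rs , v) , lift a
      HoldsLit⇒⊨τLit (neg p ts) (rs , v , ¬a) = lift (rs , v) , λ a → lift (¬a (lower a))

      ⊨τLit⇒HoldsLit : ∀ l → I ⊨ τLit l → HoldsLit l
      ⊨τLit⇒HoldsLit (pos p ts) (lift (rs , v) , lift a) = rs , v , a
      ⊨τLit⇒HoldsLit (neg p ts) (lift (rs , v) , ¬a) = rs , v , λ a → lower (¬a (lift a))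

      HoldsCmp⇒⊨τCmp : ∀ ≺ t₁ t₂ → HoldsCmp ≺ t₁ t₂ → I ⊨ τCmp ≺ t₁ t₂
      HoldsCmp⇒⊨τCmp ≺ t₁ t₂ w = lift w , λ b → b

      ⊨τCmp⇒HoldsCmp : ∀ ≺ t₁ t₂ → I ⊨ τCmp ≺ t₁ t₂ → HoldsCmp ≺ t₁ t₂
      ⊨τCmp⇒HoldsCmp ≺ t₁ t₂ (lift w , _) = w

      HoldsCs⇒⊨τCs : ∀ cs → HoldsCs cs → I ⊨ τCs cs
      HoldsCs⇒⊨τCs (clit l ∷ cs) (h ∷ _) (lift fzero) = HoldsLit⇒⊨τLit l h
      HoldsCs⇒⊨τCs (ccmp ≺ t₁ t₂ ∷ cs) (h ∷ _) (lift fzero) = HoldsCmp⇒⊨τCmp ≺ t₁ t₂ h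
      HoldsCs⇒⊨τCs (_ ∷ cs) (_ ∷ hs) (lift (fsuc i)) = HoldsCs⇒⊨τCs cs hs (lift i)

      ⊨τCs⇒HoldsCs : ∀ cs → I ⊨ τCs cs → HoldsCs cs
      ⊨τCs⇒HoldsCs [] _ = []
      ⊨τCs⇒HoldsCs (c ∷ cs) h = holds c (h (lift fzero)) ∷ ⊨τCs⇒HoldsCs cs (λ i → h (lift (fsuc (lower i))))
        where
          holds : ∀ c → I ⊨ τC c → HoldsC c
          holds (clit l) = ⊨τLit⇒HoldsLit l
          holds (ccmp ≺ t₁ t₂) = ⊨τCmp⇒HoldsCmp ≺ t₁ t₂

      -- the shape ∃𝐗 (𝐗 ∈ 𝐭 ∧ H) shared by the representations of p(𝐭) and not p(𝐭)
      ∃tuple-intro : ∀ ts H {ρ rs} → valsL (substL (progSub ρ) ts) rs →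
                     (∀ {ρ′} → Assigns ρ′ (literalVars ts) rs → truth I H ρ′) →
                     truth I (∃⃗ (literalVars ts) (memAll (literalVars ts) ts ∧F H)) ρ
      ∃tuple-intro ts H {ρ} {rs} v h =
        ∃⃗-intro (memAll Ls ts ∧F H) Ls rs len
          (∧F-intro (memAll Ls ts) H
            (memAll-intro ts as
              (subst (λ ts′ → valsL ts′ rs) (sym (substL-progSub-updates ρ Ls rs ts (prog∉literalVars ts))) v))
            (h as))
        where
          Ls = literalVars ts
          len : length rs ≡ length Ls
          len = trans (length-valsL _ v) (trans (length-substL ts) (sym (length-fresh vL (length ts))))
          as = updates-assigns ρ Ls rs (literalVars-unique ts) len

      ∃tuple-elim : ∀ ts H {ρ} → truth I (∃⃗ (literalVars ts) (memAll (literalVars ts) ts ∧F H)) ρ →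
                    Σ (List PTerm) λ rs → valsL (substL (progSub ρ) ts) rs ×
                      Σ Env λ ρ′ → Assigns ρ′ (literalVars ts) rs × truth I H ρ′
      ∃tuple-elim ts H {ρ} h =
        let (rs , len , f) = ∃⃗-elim (memAll Ls ts ∧F H) Ls h
            (m , g) = ∧F-elim (memAll Ls ts) H f
            as = updates-assigns ρ Ls rs (literalVars-unique ts) len
        in rs , subst (λ ts′ → valsL ts′ rs) (substL-progSub-updates ρ Ls rs ts (prog∉literalVars ts))
                  (memAll-elim ts as (length-fresh vL (length ts)) m)
              , _ , as , g
        where Ls = literalVars ts

      φLit⇒HoldsLit : ∀ l ρ → truth I (φLit l) ρ → HoldsLit (substLit (progSub ρ) l)
      φLit⇒HoldsLit (pos p ts) ρ h
        with rs , v , _ , as , a ← ∃tuple-elim ts (atomF p (List.map varA (literalVars ts))) h =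
        rs , v , subst (λ rs′ → I (p , rs′)) (evalL-varA as) a
      φLit⇒HoldsLit (neg p ts) ρ h
        with rs , v , _ , as , ¬a ← ∃tuple-elim ts (¬F (atomF p (List.map varA (literalVars ts)))) h =
        rs , v , λ a → ¬a (subst (λ rs′ → I (p , rs′)) (sym (evalL-varA as)) a)

      HoldsLit⇒φLit : ∀ l ρ → HoldsLit (substLit (progSub ρ) l) → truth I (φLit l) ρ
      HoldsLit⇒φLit (pos p ts) ρ (rs , v , a) =
        ∃tuple-intro ts (atomF p (List.map varA (literalVars ts))) v
          (λ as → subst (λ rs′ → I (p , rs′)) (sym (evalL-varA as)) a)
      HoldsLit⇒φLit (neg p ts) ρ (rs , v , ¬a) =
        ∃tuple-intro ts (¬F (atomF p (List.map varA (literalVars ts)))) v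
          (λ as a → ¬a (subst (λ rs′ → I (p , rs′)) (evalL-varA as) a))

      φCmp⇒HoldsCmp : ∀ ≺ t₁ t₂ ρ → truth I (φCmp ≺ t₁ t₂) ρ →
                      HoldsCmp ≺ (substT (progSub ρ) t₁) (substT (progSub ρ) t₂)
      φCmp⇒HoldsCmp ≺ t₁ t₂ ρ h =
        let (r₁ , h₁) = exF-elim (vL 0) (exF (vL 1) (⋀F (m₁ ∷ m₂ ∷ c ∷ []))) {ρ} h
            (r₂ , h₂) = exF-elim (vL 1) (⋀F (m₁ ∷ m₂ ∷ c ∷ [])) {ρ [ vL 0 ↦ r₁ ]} h₁
            (v₁ , h₃) = ⋀F-∷-elim m₁ (m₂ ∷ c ∷ []) {(ρ [ vL 0 ↦ r₁ ]) [ vL 1 ↦ r₂ ]} h₂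
            (v₂ , r₁≺r₂) = ⋀F-∷-elim m₂ (c ∷ []) {(ρ [ vL 0 ↦ r₁ ]) [ vL 1 ↦ r₂ ]} h₃
        in r₁ , r₂ , v₁ , v₂ , r₁≺r₂
        where
          m₁ = memF (varA (vL 0)) t₁
          m₂ = memF (varA (vL 1)) t₂
          c = cmpF ≺ (varA (vL 0)) (varA (vL 1))

      HoldsCmp⇒φCmp : ∀ ≺ t₁ t₂ ρ → HoldsCmp ≺ (substT (progSub ρ) t₁) (substT (progSub ρ) t₂) →
                      truth I (φCmp ≺ t₁ t₂) ρ
      HoldsCmp⇒φCmp ≺ t₁ t₂ ρ (r₁ , r₂ , v₁ , v₂ , r₁≺r₂) =
        exF-intro (vL 0) (exF (vL 1) (⋀F (m₁ ∷ m₂ ∷ c ∷ []))) {ρ} r₁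
          (exF-intro (vL 1) (⋀F (m₁ ∷ m₂ ∷ c ∷ [])) {ρ [ vL 0 ↦ r₁ ]} r₂
            (⋀F-∷-intro m₁ (m₂ ∷ c ∷ []) {ρ₂} v₁ (⋀F-∷-intro m₂ (c ∷ []) {ρ₂} v₂ r₁≺r₂)))
        where
          m₁ = memF (varA (vL 0)) t₁
          m₂ = memF (varA (vL 1)) t₂
          c = cmpF ≺ (varA (vL 0)) (varA (vL 1))
          ρ₂ = (ρ [ vL 0 ↦ r₁ ]) [ vL 1 ↦ r₂ ]

      φCs⇒HoldsCs : ∀ cs ρ → truth I (φCs cs) ρ → HoldsCs (substCs (progSub ρ) cs)
      φCs⇒HoldsCs [] ρ _ = []
      φCs⇒HoldsCs (c ∷ cs) ρ h =
        let (f , fs) = ⋀F-∷-elim (φC c) (List.map φC cs) h in holds c f ∷ φCs⇒HoldsCs cs ρ fs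
        where
          holds : ∀ c → truth I (φC c) ρ → HoldsC (substC (progSub ρ) c)
          holds (clit l) = φLit⇒HoldsLit l ρ
          holds (ccmp ≺ t₁ t₂) = φCmp⇒HoldsCmp ≺ t₁ t₂ ρ

      HoldsCs⇒φCs : ∀ cs ρ → HoldsCs (substCs (progSub ρ) cs) → truth I (φCs cs) ρ
      HoldsCs⇒φCs [] ρ [] = λ ()
      HoldsCs⇒φCs (c ∷ cs) ρ (h ∷ hs) = ⋀F-∷-intro (φC c) (List.map φC cs) (φ c h) (HoldsCs⇒φCs cs ρ hs)
        where
          φ : ∀ c → HoldsC (substC (progSub ρ) c) → truth I (φC c) ρ
          φ (clit l) = HoldsLit⇒φLit l ρ
          φ (ccmp ≺ t₁ t₂) = HoldsCmp⇒φCmp ≺ t₁ t₂ ρ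

      module ClosedAggregate (α : AggName) (ts : List⁺ Term) (cs : List CElem) (≺ : Rel) (r₀ : PTerm) where
        open Agg α ts cs ≺ (inj₂ r₀)

        satisfying : A → Set
        satisfying r = HoldsCs (substCs (σ r) cs)

        -- τAgg contains the implication for Δ = satisfying itself, whose consequent fails
        ⊨τAgg⇒justifies : I ⊨ τAgg → justifies satisfying
        ⊨τAgg⇒justifies h = ¬¬-elim λ ¬j →
          let (lift (r , r∉) , holds) = h (satisfying , ¬j) (λ i → HoldsCs⇒⊨τCs _ (proj₂ (lower i)))
          in r∉ (⊨τCs⇒HoldsCs _ holds)

        -- if the consequent for Δ failed, the antecedent would make Δ the satisfying set, which justifies
        justifies⇒⊨τAgg : justifies satisfying → I ⊨ τAgg
        justifies⇒⊨τAgg j (Δ , ¬j) Δ-holds with dec (Σ A λ r → ¬ Δ r × satisfying r)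
        ... | yes (r , r∉Δ , holds) = lift (r , r∉Δ) , HoldsCs⇒⊨τCs _ holds
        ... | no ∄ = ⊥-elim (¬j (subst (λ a → ⟦ ≺ ⟧ʳ a r₀) (aggFun-ext α _ _ same) j))
          where
            same : ∀ u → valsΔ satisfying u ⇔ valsΔ Δ u
            same u = mk⇔ (λ (r , holds , v) → r , ¬¬-elim (λ r∉Δ → ∄ (r , r∉Δ , holds)) , v)
                         (λ (r , r∈Δ , v) → r , ⊨τCs⇒HoldsCs _ (Δ-holds (lift (r , r∈Δ))) , v)

      module RuleInstance (R : Rule) (ρ : PV → PTerm) where
        σ₀ : Sub
        σ₀ = instanceSub R ρ

        record AgreesOnGlobals (E : Env) : Set where
          constructor agrees
          field agree : ∀ {x} → x ∈ globals R → E (prog x) ≡ ρ x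
        open AgreesOnGlobals

        agrees-[vY↦] : ∀ {E} y → AgreesOnGlobals E → AgreesOnGlobals (E [ vY ↦ y ])
        agrees-[vY↦] y G = agrees (agree G)

        progSub≗σ₀ : ∀ {E} → AgreesOnGlobals E → ∀ {xs} → All (_∈ globals R) xs → progSub E ≗ σ₀ on xs
        progSub≗σ₀ G = All.map (λ g → trans (cong just (agree G g)) (sym (instanceSub-global R ρ g)))

        σ₀⨾progSub : ∀ {E} → AgreesOnGlobals E → ∀ x → (σ₀ ⨾ progSub E) x ≡ progSub E x
        σ₀⨾progSub {E} G x = by-cases (x ∈V? globals R)
          where
            by-cases : (g? : Dec (x ∈ globals R)) →
                       maybe just (progSub E x) (if does g? then just (ρ x) else nothing) ≡ progSub E x
            by-cases (yes g) = cong just (sym (agree G g))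
            by-cases (no _) = refl

        globalsOf : ∀ {b} → b ∈ body R → All (_∈ globals R) (globalsB b)
        globalsOf b∈ = All.tabulate (globalsB⊆globals R b∈)

        boundValue : PV ⊎ PTerm → PTerm
        boundValue (inj₁ x) = ρ x
        boundValue (inj₂ r) = r

        substS-bound : ∀ s → All (_∈ globals R) (varsS s) → substS σ₀ s ≡ inj₂ (boundValue s)
        substS-bound (inj₁ x) (g ∷ []) = cong (maybe inj₂ (inj₁ x)) (instanceSub-global R ρ g)
        substS-bound (inj₂ r) [] = refl

        sTerm-bound : ∀ s → All (_∈ globals R) (varsS s) → ∀ {E} → AgreesOnGlobals E →
                      substT (progSub E) (sTerm s) ≡ ⌜ boundValue s ⌝
        sTerm-bound (inj₁ x) (g ∷ []) G = cong ⌜_⌝ (agree G g)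
        sTerm-bound (inj₂ r) [] G = substT-⌜⌝ _ r

        module AggregateElement (α : AggName) (t : Term) (ts : List Term) (cs : List CElem) (≺ : Rel)
                                (s : PV ⊎ PTerm) (b∈ : bagg α (t ∷ ts) cs ≺ s ∈ body R) where
          ts′ : List⁺ Term
          ts′ = substT⁺ σ₀ (t ∷ ts)

          cs′ : List CElem
          cs′ = substCs σ₀ cs

          r₀ : PTerm
          r₀ = boundValue s

          open Agg α ts′ cs′ ≺ (inj₂ r₀) using (Xs; A; σ; valsΔ)
          open ClosedAggregate α ts′ cs′ ≺ r₀ using (satisfying; ⊨τAgg⇒justifies; justifies⇒⊨τAgg)

          s-global : All (_∈ globals R) (varsS s)
          s-global = globalsOf b∈

          Zs⁺ : List⁺ Var
          Zs⁺ = aggTupleVars⁺ (length ts)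

          Zs : List Var
          Zs = aggTupleVars (length ts)

          PL : List Var
          PL = List.map prog (locals R)

          condition : Formula
          condition = memAll Zs (t ∷ ts) ∧F φCs cs

          -- the set the aggregate name α is applied to in φ^𝐗, under E
          repSet : Env → List⁺ PTerm → Set
          repSet E u = (List⁺.length u ≡ List⁺.length Zs⁺) × truth I (∃⃗ PL condition) (updates E Zs (toList u))

          inner : Env → List⁺ PTerm → List PTerm → Env
          inner E u ls = updates (updates E Zs (toList u)) PL ls

          inner-agrees : ∀ {E} → AgreesOnGlobals E → ∀ u ls → AgreesOnGlobals (inner E u ls)
          inner-agrees {E} G u ls = agrees λ {x} g →
            trans (updates-miss (updates E Zs (toList u)) PL ls (prog-global∉progLocals R g))
                  (trans (updates-miss E Zs (toList u) (λ m → aggTupleVars-disjoint-prog (length ts) (x ∷ []) m (here refl)))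
                         (agree G g))

          inner-assigns : ∀ E u ls → List⁺.length u ≡ List⁺.length Zs⁺ → Assigns (inner E u ls) Zs (toList u)
          inner-assigns E u ls len =
            Assigns-updates PL ls (λ m → aggTupleVars-disjoint-prog (length ts) (locals R) m)
              (updates-assigns E Zs (toList u) (aggTupleVars-unique (length ts)) len)

          Xs⊆locals : ∀ {x} → x ∈ Xs → x ∈ locals R
          Xs⊆locals m =
            let (unsubstituted , m′) = varsAggLeft-subst σ₀ (t ∷ ts) cs (∈-deduplicate⁻ _≟V_ _ m)
            in aggVar⇒local R (aggVarsB⊆aggVars R b∈ m′) (instanceSub-nothing R ρ unsubstituted)

          module _ {E : Env} (G : AgreesOnGlobals E) (r : A) (σ-agrees : ∀ {x} → x ∈ Xs → σ r x ≡ progSub E x) where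
            tuple-resubst : substL (σ r) (substL σ₀ (t ∷ ts)) ≡ substL (progSub E) (t ∷ ts)
            tuple-resubst = substL-resubst σ₀ (σ r) (progSub E) (t ∷ ts)
              (All.tabulate (λ m → σ-agrees (∈-deduplicate⁺ _≟V_ (∈-++⁺ˡ m)))) (σ₀⨾progSub {E} G)

            condition-resubst : substCs (σ r) cs′ ≡ substCs (progSub E) cs
            condition-resubst = substCs-resubst σ₀ (σ r) (progSub E) cs
              (All.tabulate (λ m → σ-agrees (∈-deduplicate⁺ _≟V_ (∈-++⁺ʳ (varsT⁺ ts′) m)))) (σ₀⨾progSub {E} G)

          tupleOf : Env → A
          tupleOf E = Vec.map (λ x → E (prog x)) (Vec.fromList Xs)

          σ-tupleOf : ∀ E {x} → x ∈ Xs → σ (tupleOf E) x ≡ progSub E x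
          σ-tupleOf E {x} m =
            trans (cong (λ rs → assoc Xs rs x)
                        (trans (toList-map _ (Vec.fromList Xs)) (cong (List.map _) (toList∘fromList Xs))))
                  (assoc-map Xs (λ x → E (prog x)) m)

          localValue : A → Var → PTerm
          localValue r (prog x) = fromMaybe inf (σ r x)
          localValue r _ = inf

          σ-localValue : ∀ E u r {x} → x ∈ Xs → σ r x ≡ progSub (inner E u (List.map (localValue r) PL)) x
          σ-localValue E u r m =
            let (v , e) = assoc-defined Xs (Vec.toList r) (length-toList r) m
                hit = updates-map _ PL (localValue r) (progLocals-unique R) (∈-map⁺ prog (Xs⊆locals m))
            in trans e (cong just (sym (trans hit (cong (fromMaybe inf) e))))

          repSet⇒valsΔ : ∀ {E} → AgreesOnGlobals E → ∀ u → repSet E u → valsΔ satisfying u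
          repSet⇒valsΔ {E} G (u₀ ∷ us) (len , h) =
            let (ls , _ , h′) = ∃⃗-elim condition PL h
                E′ = inner E (u₀ ∷ us) ls
                G′ = inner-agrees {E} G (u₀ ∷ us) ls
                r = tupleOf E′
                (m , c) = ∧F-elim (memAll Zs (t ∷ ts)) (φCs cs) {E′} h′
                v = memAll-elim (t ∷ ts) (inner-assigns E (u₀ ∷ us) ls len) (cong suc (length-fresh _ (length ts))) m
            in r , subst HoldsCs (sym (condition-resubst {E′} G′ r (σ-tupleOf E′))) (φCs⇒HoldsCs cs E′ c)
                 , subst (λ ts″ → valsL ts″ (u₀ ∷ us)) (sym (tuple-resubst {E′} G′ r (σ-tupleOf E′))) v

          valsΔ⇒repSet : ∀ {E} → AgreesOnGlobals E → ∀ u → valsΔ satisfying u → repSet E u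
          valsΔ⇒repSet {E} G (u₀ ∷ us) (r , holds , v) =
            len , ∃⃗-intro condition PL ls (length-map (localValue r) PL)
                    (∧F-intro (memAll Zs (t ∷ ts)) (φCs cs)
                      (memAll-intro (t ∷ ts) (inner-assigns E (u₀ ∷ us) ls len)
                        (subst (λ ts″ → valsL ts″ (u₀ ∷ us)) (tuple-resubst {E′} G′ r σ-agrees) v))
                      (HoldsCs⇒φCs cs E′ (subst HoldsCs (condition-resubst {E′} G′ r σ-agrees) holds)))
            where
              ls = List.map (localValue r) PL
              E′ = inner E (u₀ ∷ us) ls
              G′ = inner-agrees {E} G (u₀ ∷ us) ls
              σ-agrees = σ-localValue E (u₀ ∷ us) r
              len : List⁺.length (u₀ ∷ us) ≡ List⁺.length Zs⁺
              len = cong suc (trans (length-valsL _ {us} (proj₂ v))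
                               (trans (length-substL {σ r} (substL σ₀ ts))
                                 (trans (length-substL ts) (sym (length-fresh _ (length ts))))))

          repSet≡valsΔ : ∀ {E} → AgreesOnGlobals E → aggFun α (repSet E) ≡ aggFun α (valsΔ satisfying)
          repSet≡valsΔ G = aggFun-ext α _ _ (λ u → mk⇔ (repSet⇒valsΔ G u) (valsΔ⇒repSet G u))

          aggregate-≺-Y : Formula
          aggregate-≺-Y = cmpF ≺ (aggA α Zs⁺ (∃⃗ PL condition)) (varA vY)

          bounded : Formula
          bounded = aggregate-≺-Y ∧F memF (varA vY) (sTerm s)

          φ⇒⊨τ : ∀ {E} → AgreesOnGlobals E → truth I (φB (locals R) (bagg α (t ∷ ts) cs ≺ s)) E →
                 I ⊨ τB (substB σ₀ (bagg α (t ∷ ts) cs ≺ s))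
          φ⇒⊨τ {E} G h =
            let (y , h′) = exF-elim vY bounded {E} h
                (y-bound , y∈s) = ∧F-elim aggregate-≺-Y (memF (varA vY) (sTerm s)) h′
                Gʸ = agrees-[vY↦] y G
                y≡r₀ = vals-⌜⌝-unique r₀ (subst (λ t″ → vals t″ y) (sTerm-bound s s-global Gʸ) y∈s)
            in subst (λ s′ → I ⊨ Agg.τAgg α ts′ cs′ ≺ s′) (sym (substS-bound s s-global))
                 (justifies⇒⊨τAgg (subst₂ ⟦ ≺ ⟧ʳ (repSet≡valsΔ Gʸ) y≡r₀ y-bound))

          ⊨τ⇒φ : ∀ {E} → AgreesOnGlobals E → I ⊨ τB (substB σ₀ (bagg α (t ∷ ts) cs ≺ s)) →
                 truth I (φB (locals R) (bagg α (t ∷ ts) cs ≺ s)) E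
          ⊨τ⇒φ {E} G h =
            exF-intro vY bounded r₀
              (∧F-intro aggregate-≺-Y (memF (varA vY) (sTerm s)) {E [ vY ↦ r₀ ]}
                (subst (λ a → ⟦ ≺ ⟧ʳ a r₀) (sym (repSet≡valsΔ Gʳ)) j)
                (subst (λ t″ → vals t″ r₀) (sym (sTerm-bound s s-global Gʳ)) (vals-⌜⌝ r₀)))
            where
              Gʳ = agrees-[vY↦] r₀ G
              j = ⊨τAgg⇒justifies (subst (λ s′ → I ⊨ Agg.τAgg α ts′ cs′ ≺ s′) (substS-bound s s-global) h)

        φB⇒⊨τB : ∀ {E} → AgreesOnGlobals E → ∀ b → b ∈ body R → truth I (φB (locals R) b) E → I ⊨ τB (substB σ₀ b)
        φB⇒⊨τB {E} G (blit l) b∈ h =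
          HoldsLit⇒⊨τLit _ (subst HoldsLit (substLit-cong l (progSub≗σ₀ G (globalsOf b∈))) (φLit⇒HoldsLit l E h))
        φB⇒⊨τB {E} G (bcmp ≺ t₁ t₂) b∈ h =
          HoldsCmp⇒⊨τCmp ≺ _ _ (subst₂ (HoldsCmp ≺) (substT-cong t₁ (++⁻ˡ (varsT t₁) gs))
                                                    (substT-cong t₂ (++⁻ʳ (varsT t₁) gs))
                                  (φCmp⇒HoldsCmp ≺ t₁ t₂ E h))
          where gs = progSub≗σ₀ G (globalsOf b∈)
        φB⇒⊨τB G (bagg α (t ∷ ts) cs ≺ s) b∈ = AggregateElement.φ⇒⊨τ α t ts cs ≺ s b∈ G

        ⊨τB⇒φB : ∀ {E} → AgreesOnGlobals E → ∀ b → b ∈ body R → I ⊨ τB (substB σ₀ b) → truth I (φB (locals R) b) E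
        ⊨τB⇒φB {E} G (blit l) b∈ h =
          HoldsLit⇒φLit l E (subst HoldsLit (sym (substLit-cong l (progSub≗σ₀ G (globalsOf b∈)))) (⊨τLit⇒HoldsLit _ h))
        ⊨τB⇒φB {E} G (bcmp ≺ t₁ t₂) b∈ h =
          HoldsCmp⇒φCmp ≺ t₁ t₂ E (subst₂ (HoldsCmp ≺) (sym (substT-cong t₁ (++⁻ˡ (varsT t₁) gs)))
                                    (sym (substT-cong t₂ (++⁻ʳ (varsT t₁) gs))) (⊨τCmp⇒HoldsCmp ≺ _ _ h))
          where gs = progSub≗σ₀ G (globalsOf b∈)
        ⊨τB⇒φB G (bagg α (t ∷ ts) cs ≺ s) b∈ = AggregateElement.⊨τ⇒φ α t ts cs ≺ s b∈ G

        φBody⇒⊨τBody : ∀ {E} → AgreesOnGlobals E → ∀ bs → (∀ {b} → b ∈ bs → b ∈ body R) →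
                       truth I (φBody (locals R) bs) E → I ⊨ τBody (List.map (substB σ₀) bs)
        φBody⇒⊨τBody G (b ∷ bs) ⊆body h (lift fzero) =
          φB⇒⊨τB G b (⊆body (here refl)) (proj₁ (⋀F-∷-elim (φB (locals R) b) (List.map (φB (locals R)) bs) h))
        φBody⇒⊨τBody G (b ∷ bs) ⊆body h (lift (fsuc i)) =
          φBody⇒⊨τBody G bs (⊆body ∘ there)
            (proj₂ (⋀F-∷-elim (φB (locals R) b) (List.map (φB (locals R)) bs) h)) (lift i)

        ⊨τBody⇒φBody : ∀ {E} → AgreesOnGlobals E → ∀ bs → (∀ {b} → b ∈ bs → b ∈ body R) →
                       I ⊨ τBody (List.map (substB σ₀) bs) → truth I (φBody (locals R) bs) E
        ⊨τBody⇒φBody G [] _ _ = λ ()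
        ⊨τBody⇒φBody G (b ∷ bs) ⊆body h =
          ⋀F-∷-intro (φB (locals R) b) (List.map (φB (locals R)) bs)
            (⊨τB⇒φB G b (⊆body (here refl)) (h (lift fzero)))
            (⊨τBody⇒φBody G bs (⊆body ∘ there) (λ i → h (lift (fsuc (lower i)))))

      ⊨τProgram⇒⊨τRule : ∀ {Γ R} → I ⊨ τProgram Γ → R ∈ Γ → ∀ ρ → I ⊨ τRule (instanceOf R ρ)
      ⊨τProgram⇒⊨τRule sat (here refl) ρ = sat (lift (fzero , ρ))
      ⊨τProgram⇒⊨τRule sat (there m) ρ = ⊨τProgram⇒⊨τRule (λ (lift (i , ρ′)) → sat (lift (fsuc i , ρ′))) m ρ

      constraint-holds : ∀ {Γ bs} → I ⊨ τProgram Γ → constraint bs ∈ Γ →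
                         I ⊨F universalClosure (¬F (φBody (locals (constraint bs)) bs))
      constraint-holds {Γ} {bs} sat m =
        ∀⃗-intro (¬F φ) Xs {λ _ → inf} λ ws _ φ-holds →
          let ρ = λ x → updates (λ _ → inf) Xs ws (prog x)
          in lower (⊨τProgram⇒⊨τRule sat m ρ
                      (RuleInstance.φBody⇒⊨τBody (constraint bs) ρ (RuleInstance.agrees (λ _ → refl))
                         bs (λ b∈ → b∈) φ-holds))
        where
          φ = φBody (locals (constraint bs)) bs
          Xs = dedupVar (fvF (¬F φ))

      constraints-hold : ∀ {Γ} → I ⊨ τProgram Γ → ∀ Γ′ → (∀ {R} → R ∈ Γ′ → R ∈ Γ) →
                         All (I ⊨F_) (constraintFormulas Γ′)
      constraints-hold sat [] _ = []
      constraints-hold sat (constraint bs ∷ Γ′) ⊆Γ =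
        constraint-holds sat (⊆Γ (here refl)) ∷ constraints-hold sat Γ′ (⊆Γ ∘ there)
      constraints-hold sat (basic _ _ _ ∷ Γ′) ⊆Γ = constraints-hold sat Γ′ (⊆Γ ∘ there)
      constraints-hold sat (choice _ _ _ ∷ Γ′) ⊆Γ = constraints-hold sat Γ′ (⊆Γ ∘ there)

      Fires : Sym → List Term → List BElem → Atom → Set₁
      Fires q ts bs (p , rs) = (q ≡ p) × (I ⊨ τBody bs) × Lift (lsuc lzero) (valsL ts rs)

      Supports : Rule → Atom → Set₁
      Supports (basic q ts bs) = Fires q ts bs
      Supports (choice q ts bs) = Fires q ts bs
      Supports (constraint _) _ = Lift (lsuc lzero) ⊥

      unfired-head : ∀ {q ts bs a rs} → ¬ Fires q ts bs a → I ⊨ τBody bs → valsL ts rs → (q , rs) ≢ a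
      unfired-head ¬fires body-holds v refl = ¬fires (refl , body-holds , lift v)

      unsupported⇒reduct : ∀ R {a} → ¬ Supports R a → I ⊨ τRule R → (I ∖ a) ⊨red[ I ] τRule R
      unsupported⇒reduct (basic q ts bs) ¬sup sat = sat , λ body-red →
        sat (proj₁ body-red) , λ (lift (rs , v)) →
          let a = lower (sat (proj₁ body-red) (lift (rs , v)))
          in lift a , lift (a , unfired-head {bs = bs} ¬sup (proj₁ body-red) v)
      unsupported⇒reduct (choice q ts bs) {a} ¬sup sat = sat , λ body-red →
        sat (proj₁ body-red) , λ i → sat (proj₁ body-red) i , choose (proj₁ body-red) i
        where
          choose : I ⊨ τBody bs → ∀ (i : Lift _ (Σ (List PTerm) (valsL ts))) →
                   redBody (I ∖ a) I (atomI (q , proj₁ (lower i)) ∨I ¬I (atomI (q , proj₁ (lower i))))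
          choose body-holds (lift (rs , v)) with dec (I (q , rs))
          ... | yes qrs = lift true , lift qrs , lift (qrs , unfired-head {bs = bs} ¬sup body-holds v)
          ... | no ¬qrs = lift false , (λ qrs → lift (¬qrs (lower qrs))) , λ qrs → ⊥-elim (¬qrs (lower (proj₁ qrs)))
      unsupported⇒reduct (constraint bs) _ sat = sat , λ body-red → ⊥-elim (lower (sat (proj₁ body-red)))

      -- were an atom of I unsupported, I without it would satisfy the reduct, contradicting minimality
      supported : ∀ Γ → StableModel Γ I → ∀ {a} → I a →
                  Σ Rule λ R → R ∈ Γ × Σ (PV → PTerm) λ ρ → Supports (instanceOf R ρ) a
      supported Γ (_ , (sat , _) , minimal) {a} a∈I = decidable-stable em λ unsupported →
        proj₂ (minimal (I ∖ a) (λ _ → proj₁) (sat , reduct unsupported) a a∈I) refl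
        where
          reduct : ¬ (Σ Rule λ R → R ∈ Γ × Σ (PV → PTerm) λ ρ → Supports (instanceOf R ρ) a) →
                   ∀ i → (I ∖ a) ⊨red[ I ] τRule (instanceOf (List.lookup Γ (proj₁ (lower i))) (proj₂ (lower i)))
          reduct unsupported (lift (j , ρ)) =
            unsupported⇒reduct (instanceOf (List.lookup Γ j) ρ)
              (λ supp → unsupported (_ , ∈-lookup j , ρ , supp)) (sat (lift (j , ρ)))

      module CompletedDefinition (Γ : Program) (p : Sym) (n : ℕ) where
        Vs : List Var
        Vs = fresh vV n

        disjunct : Rule → Formula
        disjunct R = ∃⃗ (completionVars Vs R) (repAnte Vs R)

        module _ (vs : List PTerm) (len : length vs ≡ length Vs) where
          E₀ : Env
          E₀ = updates (λ _ → inf) Vs vs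

          E₀-assigns : Assigns E₀ Vs vs
          E₀-assigns = updates-assigns _ Vs vs (fresh-unique vV (λ { refl → refl }) n) len

          extension-assigns : ∀ R ws → Assigns (updates E₀ (completionVars Vs R) ws) Vs vs
          extension-assigns R ws = Assigns-updates (completionVars Vs R) ws (completionVars-disjoint Vs R) E₀-assigns

          disjunct⇒atom : I ⊨ τProgram Γ → ∀ R → R ∈ Γ → inDefinition (p , n) R ≡ true →
                          truth I (disjunct R) E₀ → I (p , vs)
          disjunct⇒atom sat R@(basic q ts bs) R∈ inDef h =
            let (q≡p , lts) = ⌊⌋-∧⁻ (q ≟S p) (length ts ℕ.≟ n) inDef
                (ws , _ , h′) = ∃⃗-elim (repAnte Vs R) (completionVars Vs R) h
                E = updates E₀ (completionVars Vs R) ws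
                ρ = λ x → E (prog x)
                G = RuleInstance.agrees {R} {ρ} {E} λ _ → refl
                (m , b) = ∧F-elim (memAll Vs ts) (φBody (locals R) bs) {E} h′
                v = memAll-elim ts (extension-assigns R ws) (trans (length-fresh vV n) (sym lts)) m
                v′ = subst (λ ts′ → valsL ts′ vs)
                       (substL-cong ts (RuleInstance.progSub≗σ₀ R ρ G (All.tabulate (head⊆globals R)))) v
                heads = ⊨τProgram⇒⊨τRule sat R∈ ρ (RuleInstance.φBody⇒⊨τBody R ρ G bs (λ b∈ → b∈) b)
            in subst (λ q′ → I (q′ , vs)) q≡p (lower (heads (lift (vs , v′))))
          disjunct⇒atom sat R@(choice q ts bs) R∈ inDef h =
            let (q≡p , _) = ⌊⌋-∧⁻ (q ≟S p) (length ts ℕ.≟ n) inDef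
                (ws , _ , h′) = ∃⃗-elim (repAnte Vs R) (completionVars Vs R) h
                E = updates E₀ (completionVars Vs R) ws
                At = atomF q (List.map varA Vs)
                (_ , h″) = ⋀F-∷-elim (memAll Vs ts) (φBody (locals R) bs ∷ At ∷ []) {E} h′
                (_ , a) = ⋀F-∷-elim (φBody (locals R) bs) (At ∷ []) {E} h″
            in subst (λ q′ → I (q′ , vs)) q≡p (subst (λ rs → I (q , rs)) (evalL-varA (extension-assigns R ws)) a)

          head-length : ∀ {σ} ts → valsL (substL σ ts) vs → length ts ≡ n
          head-length ts v = trans (sym (length-substL ts)) (trans (sym (length-valsL _ v)) (trans len (length-fresh vV n)))

          supported⇒inDefinition : ∀ R ρ → Supports (instanceOf R ρ) (p , vs) → inDefinition (p , n) R ≡ true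
          supported⇒inDefinition (basic q ts bs) ρ (refl , _ , lift v) =
            ⌊⌋-∧⁺ (p ≟S p) (length ts ℕ.≟ n) refl (head-length ts v)
          supported⇒inDefinition (choice q ts bs) ρ (refl , _ , lift v) =
            ⌊⌋-∧⁺ (p ≟S p) (length ts ℕ.≟ n) refl (head-length ts v)

          -- every global variable of R occurs in 𝐔, so ρ yields a witness for ∃𝐔
          module Witness (R : Rule) (ρ : PV → PTerm)
                         (globals-free : ∀ {x} → x ∈ globals R → prog x ∈ fvF (repAnte Vs R)) where
            value : Var → PTerm
            value (prog x) = ρ x
            value _ = inf

            ws : List PTerm
            ws = List.map value (completionVars Vs R)

            E : Env
            E = updates E₀ (completionVars Vs R) ws

            G : RuleInstance.AgreesOnGlobals R ρ E
            G = RuleInstance.agrees λ g →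
              updates-map E₀ (completionVars Vs R) value (completionVars-unique Vs R)
                (fv⇒completionVar Vs R (globals-free g) (prog∉fresh vV n (λ _ ())))

            witness-intro : truth I (repAnte Vs R) E → truth I (disjunct R) E₀
            witness-intro = ∃⃗-intro (repAnte Vs R) (completionVars Vs R) ws (length-map value (completionVars Vs R))

            head-vals : ∀ ts → All (_∈ globals R) (varsL ts) →
                        valsL (substL (instanceSub R ρ) ts) vs → valsL (substL (progSub E) ts) vs
            head-vals ts gs = subst (λ ts′ → valsL ts′ vs) (sym (substL-cong ts (RuleInstance.progSub≗σ₀ R ρ G gs)))

          supported⇒disjunct : ∀ R ρ → Supports (instanceOf R ρ) (p , vs) → I (p , vs) → truth I (disjunct R) E₀
          supported⇒disjunct R@(basic q ts bs) ρ (refl , b , lift v) _ =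
            witness-intro
              (∧F-intro (memAll Vs ts) (φBody (locals R) bs)
                (memAll-intro ts (extension-assigns R ws) (head-vals ts (All.tabulate (head⊆globals R)) v))
                (RuleInstance.⊨τBody⇒φBody R ρ G bs (λ b∈ → b∈) b))
            where open Witness R ρ (fv-repAnte-basic Vs q ts bs (trans (length-fresh vV n) (sym (head-length ts v))))
          supported⇒disjunct R@(choice q ts bs) ρ (refl , b , lift v) a =
            witness-intro
              (⋀F-∷-intro (memAll Vs ts) (φBody (locals R) bs ∷ At ∷ [])
                (memAll-intro ts (extension-assigns R ws) (head-vals ts (All.tabulate (head⊆globals R)) v))
                (⋀F-∷-intro (φBody (locals R) bs) (At ∷ [])
                  (RuleInstance.⊨τBody⇒φBody R ρ G bs (λ b∈ → b∈) b)
                  (subst (λ rs → I (q , rs)) (sym (evalL-varA (extension-assigns R ws))) a)))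
            where
              open Witness R ρ (fv-repAnte-choice Vs q ts bs (trans (length-fresh vV n) (sym (head-length ts v))))
              At = atomF q (List.map varA Vs)

        holds : StableModel Γ I → I ⊨F completedDefinition Γ (p , n)
        holds sm = ∀⃗-intro (At ↔F ⋁F Ds) Vs {λ _ → inf} λ vs len →
          ∧F-intro (impF At (⋁F Ds)) (impF (⋁F Ds) At) (only-if vs len) (if vs len)
          where
            At = atomF p (List.map varA Vs)
            Ds = List.map disjunct (definition Γ (p , n))
            sat = proj₁ (proj₁ (proj₂ sm))

            only-if : ∀ vs len → truth I (impF At (⋁F Ds)) (E₀ vs len)
            only-if vs len a =
              let a′ = subst (λ rs → I (p , rs)) (evalL-varA (E₀-assigns vs len)) a
                  (R , R∈ , ρ , supp) = supported Γ sm a′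
                  R∈def = ∈-definition⁺ (p , n) Γ R∈ (supported⇒inDefinition vs len R ρ supp)
              in ⋁F-intro Ds (lose (∈-map⁺ disjunct R∈def) (supported⇒disjunct vs len R ρ supp a′))

            if : ∀ vs len → truth I (impF (⋁F Ds) At) (E₀ vs len)
            if vs len h =
              let (R , R∈def , d) = find (map⁻ (⋁F-elim Ds h))
                  (R∈ , inDef) = ∈-definition⁻ (p , n) Γ R∈def
              in subst (λ rs → I (p , rs)) (sym (evalL-varA (E₀-assigns vs len)))
                   (disjunct⇒atom vs len sat R R∈ inDef d)

      stableModel⇒completion : ∀ Γ → StableModel Γ I → SatisfiesCompletion Γ I
      stableModel⇒completion Γ sm =
        ++⁺ (All-map⁺ (All.universal (λ (p , n) → CompletedDefinition.holds Γ p n sm) (preds Γ)))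
            (constraints-hold (proj₁ (proj₁ (proj₂ sm))) Γ (λ R∈ → R∈))

theorem1 : (S : Sig) (O : Structure S) → ExcludedMiddle (lsuc lzero) →
    let open Semantics S O in
    (Γ : Program) (I : Interp) → StableModel Γ I → SatisfiesCompletion Γ I
theorem1 S O em Γ I = stableModel⇒completion S O em I Γ
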